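{- Let $\mathcal A\subseteq\mathbb N$, $L$ an environment and $T$ a term. If $L\vdash_{\mathcal A}T$, then the closure $(L,T)$ is strongly qrst-normalizing.
   Context: Fix a nonempty set $\Sigma$ of sorts with decidable equality, an arbitrary function $\mathrm{next}:\Sigma\to\Sigma$, and a countably infinite set of variables. Terms and environments: $T,U,V,W ::= \star s \mid x \mid \mathrm{app}(V,T) \mid \lambda x{:}W.\,T \mid \mathrm{def}(x{=}V).\,T \mid \mathrm{cast}(U,T)$ ($s\in\Sigma$) and $L,K ::= \emptyset \mid K,x{:}W \mid K,x{=}V$. $\mathrm{app}(V,T)$ applies $T$ to $V$; $\lambda x{:}W.\,T$ (de Bruijn's abstraction) and $\mathrm{def}(x{=}V).\,T$ (local definition) bind $x$ in $T$; $\mathrm{cast}(U,T)$ annotates $T$ with expected type $U$; entries $x{:}W$ and $x{=}V$ bind $x$. Terms are modulo renaming of bound variables, with bound variables distinct from each other and from free ones. Write $\mathsf{B}x[V]$ for either $\lambda x{:}V$ or $\mathrm{def}(x{=}V)$ and correspondingly $L,x[V]$ for $L,x{:}V$ resp. $L,x{=}V$ (same kind within a rule). A closure is a pair $(L,T)$. Bound rt-reduction $L\vdash T_1\to^nT_2$ is the smallest relation closed under: $L\vdash\mathrm{app}(V,\lambda x{:}W.\,T)\to^0\mathrm{def}(x{=}\mathrm{cast}(W,V)).\,T$; $K,x{=}V\vdash x\to^0V$; $L\vdash\mathrm{def}(x{=}V).\,T\to^0T$ if $x$ not free in $T$; $L\vdash\mathrm{app}(V,\mathrm{def}(x{=}W).\,T)\to^0\mathrm{def}(x{=}W).\,\mathrm{app}(V,T)$;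 $L\vdash\mathrm{cast}(U,T)\to^0T$; $L\vdash\star s\to^1\star\,\mathrm{next}(s)$; $K,x{:}W\vdash x\to^1W$; $L\vdash\mathrm{cast}(U,T)\to^1U$; if $K\vdash x\to^nT$, $y\neq x$, $y$ not free in $T$ then $K,y[V]\vdash x\to^nT$; if $L\vdash V_1\to^0V_2$ then $L\vdash\mathrm{app}(V_1,T)\to^0\mathrm{app}(V_2,T)$; if $L\vdash T_1\to^nT_2$ then $L\vdash\mathrm{app}(V,T_1)\to^n\mathrm{app}(V,T_2)$; if $L\vdash V_1\to^0V_2$ then $L\vdash\mathsf Bx[V_1].\,T\to^0\mathsf Bx[V_2].\,T$; if $L,x[V]\vdash T_1\to^nT_2$ then $L\vdash\mathsf Bx[V].\,T_1\to^n\mathsf Bx[V].\,T_2$; if $L\vdash U_1\to^0U_2$ then $L\vdash\mathrm{cast}(U_1,T)\to^0\mathrm{cast}(U_2,T)$; if $L\vdash T_1\to^0T_2$ then $L\vdash\mathrm{cast}(U,T_1)\to^0\mathrm{cast}(U,T_2)$; if $L\vdash U_1\to^1U_2$ and $L\vdash T_1\to^1T_2$ then $L\vdash\mathrm{cast}(U_1,T_1)\to^1\mathrm{cast}(U_2,T_2)$. $L\vdash T_1\to^{*n}T_2$ is the smallest relation with $L\vdash T\to^{*0}T$, containing single steps, and with $L\vdash T_1\to^{*n_1}T$, $L\vdash T\to^{*n_2}T_2$ implying $L\vdash T_1\to^{*n_1+n_2}T_2$. Validity $L\vdash_{\mathcal A}T$ is the smallest predicate closed under: $L\vdash_{\mathcal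 A}\star s$; if $K\vdash_{\mathcal A}V$ then $K,x[V]\vdash_{\mathcal A}x$; if $K\vdash_{\mathcal A}x$ and $y\neq x$ then $K,y[V]\vdash_{\mathcal A}x$; if $L\vdash_{\mathcal A}V$ and $L,x[V]\vdash_{\mathcal A}T$ then $L\vdash_{\mathcal A}\mathsf Bx[V].\,T$; if $L\vdash_{\mathcal A}U$, $L\vdash_{\mathcal A}T$ and some $U_0$ satisfies $L\vdash T\to^{*1}U_0$, $L\vdash U\to^{*0}U_0$, then $L\vdash_{\mathcal A}\mathrm{cast}(U,T)$; if $L\vdash_{\mathcal A}V$, $L\vdash_{\mathcal A}T$ and there are $n\in\mathcal A$, $x,W_0,U_0$ with $L\vdash T\to^{*n}\lambda x{:}W_0.\,U_0$ and $L\vdash V\to^{*1}W_0$, then $L\vdash_{\mathcal A}\mathrm{app}(V,T)$. Extended rt-reduction $L\vdash T_1\leadsto T_2$ is the smallest relation closed under: $L\vdash\mathrm{app}(V,\lambda x{:}W.\,T)\leadsto\mathrm{def}(x{=}\mathrm{cast}(W,V)).\,T$; $L\vdash\mathrm{app}(V,\mathrm{def}(x{=}W).\,T)\leadsto\mathrm{def}(x{=}W).\,\mathrm{app}(V,T)$; $K,x[V]\vdash x\leadsto V$; $L\vdash\mathrm{def}(x{=}V).\,T\leadsto T$ if $x$ not free in $T$; $L\vdash\mathrm{cast}(U,T)\leadsto T$; $L\vdash\star s_1\leadsto\star s_2$ for any $s_1,s_2\in\Sigma$; $L\vdash\mathrm{cast}(U,T)\leadsto U$; if $K\vdash x\leadsto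 T$, $y\neq x$, $y$ not free in $T$ then $K,y[V]\vdash x\leadsto T$; if $L\vdash V_1\leadsto V_2$ then $L\vdash\mathrm{app}(V_1,T)\leadsto\mathrm{app}(V_2,T)$, $L\vdash\mathsf Bx[V_1].\,T\leadsto\mathsf Bx[V_2].\,T$ and $L\vdash\mathrm{cast}(V_1,T)\leadsto\mathrm{cast}(V_2,T)$; if $L\vdash T_1\leadsto T_2$ then $L\vdash\mathrm{app}(V,T_1)\leadsto\mathrm{app}(V,T_2)$ and $L\vdash\mathrm{cast}(U,T_1)\leadsto\mathrm{cast}(U,T_2)$; if $L,x[V]\vdash T_1\leadsto T_2$ then $L\vdash\mathsf Bx[V].\,T_1\leadsto\mathsf Bx[V].\,T_2$. On environments, $L_1\leadsto L_2$ is the smallest relation such that $K_1\leadsto K_2$ implies $K_1,y[V]\leadsto K_2,y[V]$, and $K\vdash V_1\leadsto V_2$ implies $K,y[V_1]\leadsto K,y[V_2]$. Direct subclosure $(L_1,T_1)\sqsupset(L_2,T_2)$ holds in exactly these cases: $(K,x[V],x)\sqsupset(K,V)$; $(K,y[V],T)\sqsupset(K,T)$ if $y$ is not free in $T$; $(L,\mathrm{app}(V,T))\sqsupset(L,V)$ and $\sqsupset(L,T)$; $(L,\mathrm{cast}(V,T))\sqsupset(L,V)$ and $\sqsupset(L,T)$; $(L,\mathsf Bx[V].\,T)\sqsupset(L,V)$ and $\sqsupset(L,x[V],T)$. Inherited free variables $F(L,T)$: $F(L,\star s)=\emptyset$; $F(K,x[V],x)=F(K,V)\cup\{x\}$; $F(\emptyset,x)=\{x\}$;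 $F(K,y[V],x)=F(K,x)$ for $y\ne x$; $F(L,\mathsf Bx[V].\,T)=F(L,V)\cup(F(L,x[V],T)\setminus\{x\})$; $F(L,\mathrm{app}(V,T))=F(L,\mathrm{cast}(V,T))=F(L,V)\cup F(L,T)$. For a finite set $f$ of variables, $L_1=_fL_2$ is the smallest relation with: $\emptyset=_f\emptyset$; if $K_1=_fK_2$ and $y\notin f$ then $K_1,y[V_1]=_fK_2,y[V_2]$; if $K_1=_fK_2$, $y\notin f$ and $V_1=V_2$ then $K_1,y[V_1]=_{f\cup\{y\}}K_2,y[V_2]$ (entries of the same kind). $L_1=_TL_2$ means $L_1=_{F(L_1,T)}L_2$. Sort irrelevance on terms $T_1\approx T_2$: $\star s_1\approx\star s_2$ for all sorts; $x\approx x$; $\mathsf Bx[V_1].\,T_1\approx\mathsf Bx[V_2].\,T_2$, $\mathrm{app}(V_1,T_1)\approx\mathrm{app}(V_2,T_2)$, $\mathrm{cast}(V_1,T_1)\approx\mathrm{cast}(V_2,T_2)$ whenever $V_1\approx V_2$ and $T_1\approx T_2$. On environments $L_1\approx_fL_2$ is defined like $=_f$ but with $V_1\approx V_2$ in place of $V_1=V_2$. On closures $(L_1,T_1)\approx(L_2,T_2)$ iff $L_1\approx_{F(L_1,T_1)}L_2$ and $T_1\approx T_2$. One qrst-step $(L_1,T_1)\succ(L_2,T_2)$ holds if: $L_1=L_2$ and $L_1\vdash T_1\leadsto T_2$; or $T_1=T_2$ and $L_1\leadsto L_2$; or $T_1=T_2$ and $L_1=_{T_1}L_2$; or $(L_1,T_1)\sqsupset(L_2,T_2)$.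 Strong qrst-normalization is the smallest predicate $\mathrm{SN}$ on closures such that $\mathrm{SN}(L_1,T_1)$ holds whenever $\mathrm{SN}(L_2,T_2)$ holds for all $(L_2,T_2)$ with $(L_1,T_1)\succ(L_2,T_2)$ and $(L_1,T_1)\not\approx(L_2,T_2)$. -}

module Defs where

open import Data.Nat using (ℕ; zero; suc; _+_; _<ᵇ_)
open import Data.Bool using (if_then_else_)
open import Data.Product using (_×_)
open import Relation.Nullary using (¬_)
open import Relation.Binary.PropositionalEquality using (_≡_)

-- Terms are represented with de Bruijn indices (terms modulo renaming of
-- bound variables).  Index i refers to the i-th entry of the environment
-- counted from its right end (0 = last entry); indices beyond the length of
-- the environment are free variables.

-- binder kinds: abst = λx:W (entry x:W), abbr = def(x=V) (entry x=V)
data Bind : Set where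
  abst abbr : Bind

module System (S : Set) (next : S → S) where

  data Term : Set where
    sort : S → Term
    lref : ℕ → Term
    app  : Term → Term → Term          -- app V T : T applied to V
    bind : Bind → Term → Term → Term   -- bind b V T : Bx[V].T (binds in T only)
    cast : Term → Term → Term

  data Env : Set where
    ∅    : Env
    snoc : Env → Bind → Term → Env

  lift : ℕ → Term → Term
  lift d (sort s)     = sort s
  lift d (lref i)     = if i <ᵇ d then lref i else lref (suc i)
  lift d (app V T)    = app (lift d V) (lift d T)
  lift d (bind b V T) = bind b (lift d V) (lift (suc d) T)
  lift d (cast U T)   = cast (lift d U) (lift d T)
  -- "x not free in T" for the variable x bound just outside T is expressed
  -- as T being of the form lift 0 T', and the T of the named rule is T'.

  data _⊢_⇒[_]_ : Env → Term → ℕ → Term → Set where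
    r-beta  : ∀ {L V W T} → L ⊢ app V (bind abst W T) ⇒[ 0 ] bind abbr (cast W V) T
    r-delta : ∀ {K V} → snoc K abbr V ⊢ lref 0 ⇒[ 0 ] lift 0 V
    r-zeta  : ∀ {L V T} → L ⊢ bind abbr V (lift 0 T) ⇒[ 0 ] T
    r-theta : ∀ {L V W T} → L ⊢ app V (bind abbr W T) ⇒[ 0 ] bind abbr W (app (lift 0 V) T)
    r-eps   : ∀ {L U T} → L ⊢ cast U T ⇒[ 0 ] T
    r-sort  : ∀ {L s} → L ⊢ sort s ⇒[ 1 ] sort (next s)
    r-ell   : ∀ {K W} → snoc K abst W ⊢ lref 0 ⇒[ 1 ] lift 0 W
    r-ee    : ∀ {L U T} → L ⊢ cast U T ⇒[ 1 ] U
    r-lref  : ∀ {K i n T b V} → K ⊢ lref i ⇒[ n ] T → snoc K b V ⊢ lref (suc i) ⇒[ n ] lift 0 T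
    r-appV  : ∀ {L V₁ V₂ T} → L ⊢ V₁ ⇒[ 0 ] V₂ → L ⊢ app V₁ T ⇒[ 0 ] app V₂ T
    r-appT  : ∀ {L V T₁ T₂ n} → L ⊢ T₁ ⇒[ n ] T₂ → L ⊢ app V T₁ ⇒[ n ] app V T₂
    r-bindV : ∀ {L b V₁ V₂ T} → L ⊢ V₁ ⇒[ 0 ] V₂ → L ⊢ bind b V₁ T ⇒[ 0 ] bind b V₂ T
    r-bindT : ∀ {L b V T₁ T₂ n} → snoc L b V ⊢ T₁ ⇒[ n ] T₂ → L ⊢ bind b V T₁ ⇒[ n ] bind b V T₂
    r-castU : ∀ {L U₁ U₂ T} → L ⊢ U₁ ⇒[ 0 ] U₂ → L ⊢ cast U₁ T ⇒[ 0 ] cast U₂ T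
    r-castT : ∀ {L U T₁ T₂} → L ⊢ T₁ ⇒[ 0 ] T₂ → L ⊢ cast U T₁ ⇒[ 0 ] cast U T₂
    r-cast1 : ∀ {L U₁ U₂ T₁ T₂} → L ⊢ U₁ ⇒[ 1 ] U₂ → L ⊢ T₁ ⇒[ 1 ] T₂ →
              L ⊢ cast U₁ T₁ ⇒[ 1 ] cast U₂ T₂

  data _⊢_⇒*[_]_ : Env → Term → ℕ → Term → Set where
    rs-refl  : ∀ {L T} → L ⊢ T ⇒*[ 0 ] T
    rs-step  : ∀ {L T₁ T₂ n} → L ⊢ T₁ ⇒[ n ] T₂ → L ⊢ T₁ ⇒*[ n ] T₂
    rs-trans : ∀ {L T₁ T T₂ n₁ n₂} → L ⊢ T₁ ⇒*[ n₁ ] T → L ⊢ T ⇒*[ n₂ ] T₂ →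
               L ⊢ T₁ ⇒*[ n₁ + n₂ ] T₂

  -- validity  L ⊢_A T   (A ⊆ ℕ given as a predicate)
  data Valid (A : ℕ → Set) : Env → Term → Set where
    v-sort : ∀ {L s} → Valid A L (sort s)
    v-zero : ∀ {K b V} → Valid A K V → Valid A (snoc K b V) (lref 0)
    v-suc  : ∀ {K b V i} → Valid A K (lref i) → Valid A (snoc K b V) (lref (suc i))
    v-bind : ∀ {L b V T} → Valid A L V → Valid A (snoc L b V) T → Valid A L (bind b V T)
    v-cast : ∀ {L U T} → Valid A L U → Valid A L T →
             (U₀ : Term) → L ⊢ T ⇒*[ 1 ] U₀ → L ⊢ U ⇒*[ 0 ] U₀ →
             Valid A L (cast U T)
    v-app  : ∀ {L V T} → Valid A L V → Valid A L T →
             (n : ℕ) → A n → (W₀ U₀ : Term) →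
             L ⊢ T ⇒*[ n ] bind abst W₀ U₀ → L ⊢ V ⇒*[ 1 ] W₀ →
             Valid A L (app V T)

  data _⊢_⤳_ : Env → Term → Term → Set where
    x-beta  : ∀ {L V W T} → L ⊢ app V (bind abst W T) ⤳ bind abbr (cast W V) T
    x-theta : ∀ {L V W T} → L ⊢ app V (bind abbr W T) ⤳ bind abbr W (app (lift 0 V) T)
    x-lref0 : ∀ {K b V} → snoc K b V ⊢ lref 0 ⤳ lift 0 V
    x-zeta  : ∀ {L V T} → L ⊢ bind abbr V (lift 0 T) ⤳ T
    x-eps   : ∀ {L U T} → L ⊢ cast U T ⤳ T
    x-sort  : ∀ {L s₁ s₂} → L ⊢ sort s₁ ⤳ sort s₂
    x-ee    : ∀ {L U T} → L ⊢ cast U T ⤳ U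
    x-lref  : ∀ {K i T b V} → K ⊢ lref i ⤳ T → snoc K b V ⊢ lref (suc i) ⤳ lift 0 T
    x-appV  : ∀ {L V₁ V₂ T} → L ⊢ V₁ ⤳ V₂ → L ⊢ app V₁ T ⤳ app V₂ T
    x-bindV : ∀ {L b V₁ V₂ T} → L ⊢ V₁ ⤳ V₂ → L ⊢ bind b V₁ T ⤳ bind b V₂ T
    x-castU : ∀ {L V₁ V₂ T} → L ⊢ V₁ ⤳ V₂ → L ⊢ cast V₁ T ⤳ cast V₂ T
    x-appT  : ∀ {L V T₁ T₂} → L ⊢ T₁ ⤳ T₂ → L ⊢ app V T₁ ⤳ app V T₂
    x-castT : ∀ {L U T₁ T₂} → L ⊢ T₁ ⤳ T₂ → L ⊢ cast U T₁ ⤳ cast U T₂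
    x-bindT : ∀ {L b V T₁ T₂} → snoc L b V ⊢ T₁ ⤳ T₂ → L ⊢ bind b V T₁ ⤳ bind b V T₂

  data _⤳ₑ_ : Env → Env → Set where
    xe-tail : ∀ {K₁ K₂ b V} → K₁ ⤳ₑ K₂ → snoc K₁ b V ⤳ₑ snoc K₂ b V
    xe-head : ∀ {K b V₁ V₂} → K ⊢ V₁ ⤳ V₂ → snoc K b V₁ ⤳ₑ snoc K b V₂

  data Sub : Env → Term → Env → Term → Set where
    sub-lref0 : ∀ {K b V} → Sub (snoc K b V) (lref 0) K V
    sub-drop  : ∀ {K b V T} → Sub (snoc K b V) (lift 0 T) K T
    sub-appV  : ∀ {L V T} → Sub L (app V T) L V
    sub-appT  : ∀ {L V T} → Sub L (app V T) L T
    sub-castU : ∀ {L V T} → Sub L (cast V T) L V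
    sub-castT : ∀ {L V T} → Sub L (cast V T) L T
    sub-bindV : ∀ {L b V T} → Sub L (bind b V T) L V
    sub-bindT : ∀ {L b V T} → Sub L (bind b V T) (snoc L b V) T

  -- inherited free variables: Free L T i  means  i ∈ F(L,T)
  -- (i a de Bruijn index relative to L)
  data Free : Env → Term → ℕ → Set where
    f-here  : ∀ {K b V} → Free (snoc K b V) (lref 0) 0
    f-entry : ∀ {K b V i} → Free K V i → Free (snoc K b V) (lref 0) (suc i)
    f-empty : ∀ {i} → Free ∅ (lref i) i
    f-lref  : ∀ {K b V i j} → Free K (lref i) j → Free (snoc K b V) (lref (suc i)) (suc j)
    f-bindV : ∀ {L b V T i} → Free L V i → Free L (bind b V T) i
    f-bindT : ∀ {L b V T i} → Free (snoc L b V) T (suc i) → Free L (bind b V T) i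
    f-appV  : ∀ {L V T i} → Free L V i → Free L (app V T) i
    f-appT  : ∀ {L V T i} → Free L T i → Free L (app V T) i
    f-castU : ∀ {L V T i} → Free L V i → Free L (cast V T) i
    f-castT : ∀ {L V T i} → Free L T i → Free L (cast V T) i

  -- environments agreeing (up to R) on the entries in f:
  -- EnvRel _≡_ f is  =_f ,  EnvRel _≈_ f is  ≈_f
  data EnvRel (R : Term → Term → Set) : (ℕ → Set) → Env → Env → Set₁ where
    er-empty : ∀ {f} → EnvRel R f ∅ ∅
    er-skip  : ∀ {f K₁ K₂ b V₁ V₂} → EnvRel R (λ i → f (suc i)) K₁ K₂ → ¬ f 0 →
               EnvRel R f (snoc K₁ b V₁) (snoc K₂ b V₂)
    er-keep  : ∀ {f K₁ K₂ b V₁ V₂} → EnvRel R (λ i → f (suc i)) K₁ K₂ → f 0 → R V₁ V₂ →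
               EnvRel R f (snoc K₁ b V₁) (snoc K₂ b V₂)

  data _≈_ : Term → Term → Set where
    ≈-sort : ∀ {s₁ s₂} → sort s₁ ≈ sort s₂
    ≈-lref : ∀ {i} → lref i ≈ lref i
    ≈-bind : ∀ {b V₁ V₂ T₁ T₂} → V₁ ≈ V₂ → T₁ ≈ T₂ → bind b V₁ T₁ ≈ bind b V₂ T₂
    ≈-app  : ∀ {V₁ V₂ T₁ T₂} → V₁ ≈ V₂ → T₁ ≈ T₂ → app V₁ T₁ ≈ app V₂ T₂
    ≈-cast : ∀ {V₁ V₂ T₁ T₂} → V₁ ≈ V₂ → T₁ ≈ T₂ → cast V₁ T₁ ≈ cast V₂ T₂

  ClosureApprox : Env → Term → Env → Term → Set₁
  ClosureApprox L₁ T₁ L₂ T₂ = EnvRel _≈_ (Free L₁ T₁) L₁ L₂ × T₁ ≈ T₂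

  data Step : Env → Term → Env → Term → Set₁ where
    st-red : ∀ {L T₁ T₂} → L ⊢ T₁ ⤳ T₂ → Step L T₁ L T₂
    st-env : ∀ {L₁ L₂ T} → L₁ ⤳ₑ L₂ → Step L₁ T L₂ T
    st-eq  : ∀ {L₁ L₂ T} → EnvRel _≡_ (Free L₁ T) L₁ L₂ → Step L₁ T L₂ T
    st-sub : ∀ {L₁ T₁ L₂ T₂} → Sub L₁ T₁ L₂ T₂ → Step L₁ T₁ L₂ T₂

  data SN : Env → Term → Set₁ where
    sn : ∀ {L₁ T₁} →
         (∀ L₂ T₂ → Step L₁ T₁ L₂ T₂ → ¬ ClosureApprox L₁ T₁ L₂ T₂ → SN L₂ T₂) →
         SN L₁ T₁

-- A valid term has a simple-type "skeleton": sorts get the base type ι,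
-- λx:W.T gets ρ ⇒ τ when W gets ρ and T gets τ, definitions are transparent,
-- and the two sides of casts and applications must agree (validity forces
-- this because rt-reduction preserves skeletons).  Skeleton-typed terms are
-- translated into a simply typed target calculus with casts and "kept"
-- definitions (tkeep t v keeps the definiens v next to the instantiated body
-- t, so no redex is ever erased); typed target terms are strongly
-- normalizing by Tait's reducibility method.  Every extended rt-step that is
-- not a mere change of sorts is simulated by at least one target step, or
-- leaves the translation unchanged and decreases a weight (unfolding of a
-- local definition).  So a closed typed term has no infinite chain of
-- non-trivial ⤳-steps.
--
-- For an arbitrary closure (L,T) we replace by a sort every entry of L that
-- the skeleton typing leaves untyped (T does not depend on it), and close
-- the result into one term C.  Then (L,T) is
-- reached from (∅,C) by subclosure steps, and each non-trivial qrst-step of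
-- such a subclosure lifts to a non-trivial ⤳-step of C.  Strong normalization
-- follows by well-founded induction on C, and on the size of (L,T) for
-- subclosure steps.
module Submission where

open import Defs
open import Data.Nat using (ℕ; zero; suc; pred; _+_; _≤_; _<_; z≤n; s≤s; _<ᵇ_)
open import Data.Nat.Properties
  using (≤-refl; +-mono-≤; +-mono-<-≤; <⇒≤; m<m+n; m≤m+n; m≤n+m; +-monoʳ-<; +-monoˡ-<; +-assoc)
open import Data.Nat.Induction using (<-wellFounded)
open import Data.Bool using (true; false; if_then_else_)
open import Data.Maybe using (Maybe; just; nothing)
open import Data.Product using (_×_; _,_; Σ; ∃)
open import Data.Sum using (_⊎_; inj₁; inj₂)
open import Data.Empty using (⊥; ⊥-elim)
open import Data.Unit using (⊤; tt)
open import Function using (flip)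
open import Induction.WellFounded using (Acc; acc)
open import Relation.Nullary using (¬_)
open import Relation.Binary.PropositionalEquality
open import Relation.Binary.Definitions using (DecidableEquality)
open import Relation.Binary.Construct.Closure.ReflexiveTransitive using (Star; ε; _◅_; _◅◅_; gmap)

SNᴿ : {A : Set} → (A → A → Set) → A → Set
SNᴿ R = Acc (flip R)

infixr 5 _◅⁺_
data Plus {A : Set} (R : A → A → Set) : A → A → Set where
  _◅⁺_ : ∀ {a b c} → R a b → Star R b c → Plus R a c

module _ {A : Set} {R : A → A → Set} where

  [_]⁺ : ∀ {a b} → R a b → Plus R a b
  [ r ]⁺ = r ◅⁺ ε

  plus⇒star : ∀ {a b} → Plus R a b → Star R a b
  plus⇒star (r ◅⁺ s) = r ◅ s

  _⁺◅◅_ : ∀ {a b c} → Plus R a b → Star R b c → Plus R a c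
  (r ◅⁺ s) ⁺◅◅ q = r ◅⁺ (s ◅◅ q)

  _◅◅⁺_ : ∀ {a b c} → Star R a b → Plus R b c → Plus R a c
  ε ◅◅⁺ p = p
  (r ◅ s) ◅◅⁺ p = r ◅⁺ (s ◅◅ plus⇒star p)

plus-map : ∀ {A B : Set} {R : A → A → Set} {Q : B → B → Set} (f : A → B) →
  (∀ {a b} → R a b → Q (f a) (f b)) → ∀ {a b} → Plus R a b → Plus Q (f a) (f b)
plus-map f g (r ◅⁺ s) = g r ◅⁺ gmap f g s

sn-simulation : ∀ {A B : Set} {R : A → A → Set} {Q : B → B → Set} (f : A → B) →
  (∀ {a a'} → R a a' → Plus Q (f a) (f a')) →
  ∀ {b} → SNᴿ Q b → ∀ {a} → Star Q b (f a) → SNᴿ R a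
sn-simulation {R = R} {Q} f simulate (acc h) b⟶fa = acc λ r → continue (b⟶fa ◅◅⁺ simulate r)
  where continue : ∀ {a'} → Plus Q _ (f a') → SNᴿ R a'
        continue (q ◅⁺ s) = sn-simulation f simulate (h q) s

-- The target calculus: simply typed λ-terms with casts and kept
-- definitions, in de Bruijn notation.  tkeep t v is t together with an
-- inert copy of v; it is what a local definition def(x=v).t becomes once its
-- variable has been substituted.

data TT : Set where
  tsort : TT
  tvar  : ℕ → TT
  tapp  : TT → TT → TT      -- tapp u t : t applied to u
  tlam  : TT → TT → TT      -- tlam w t : λ:w. t
  tcast : TT → TT → TT
  tkeep : TT → TT → TT

infixr 5 _∷ᶠ_
_∷ᶠ_ : ∀ {A : Set} → A → (ℕ → A) → ℕ → A
(x ∷ᶠ f) zero = x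
(x ∷ᶠ f) (suc i) = f i

ext : (ℕ → ℕ) → ℕ → ℕ
ext f zero = zero
ext f (suc i) = suc (f i)

tren : (ℕ → ℕ) → TT → TT
tren f tsort = tsort
tren f (tvar i) = tvar (f i)
tren f (tapp u t) = tapp (tren f u) (tren f t)
tren f (tlam w t) = tlam (tren f w) (tren (ext f) t)
tren f (tcast u t) = tcast (tren f u) (tren f t)
tren f (tkeep t v) = tkeep (tren f t) (tren f v)

tlift : TT → TT
tlift = tren suc

exts : (ℕ → TT) → ℕ → TT
exts ρ zero = tvar zero
exts ρ (suc i) = tlift (ρ i)

tsub : (ℕ → TT) → TT → TT
tsub ρ tsort = tsort
tsub ρ (tvar i) = ρ i
tsub ρ (tapp u t) = tapp (tsub ρ u) (tsub ρ t)
tsub ρ (tlam w t) = tlam (tsub ρ w) (tsub (exts ρ) t)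
tsub ρ (tcast u t) = tcast (tsub ρ u) (tsub ρ t)
tsub ρ (tkeep t v) = tkeep (tsub ρ t) (tsub ρ v)

tren-cong : ∀ {f g} → f ≗ g → ∀ t → tren f t ≡ tren g t
tren-cong e tsort = refl
tren-cong e (tvar i) = cong tvar (e i)
tren-cong e (tapp u t) = cong₂ tapp (tren-cong e u) (tren-cong e t)
tren-cong {f} {g} e (tlam w t) = cong₂ tlam (tren-cong e w) (tren-cong e' t)
  where e' : ext f ≗ ext g
        e' zero = refl
        e' (suc i) = cong suc (e i)
tren-cong e (tcast u t) = cong₂ tcast (tren-cong e u) (tren-cong e t)
tren-cong e (tkeep u t) = cong₂ tkeep (tren-cong e u) (tren-cong e t)

tsub-cong : ∀ {f g} → f ≗ g → ∀ t → tsub f t ≡ tsub g t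
tsub-cong e tsort = refl
tsub-cong e (tvar i) = e i
tsub-cong e (tapp u t) = cong₂ tapp (tsub-cong e u) (tsub-cong e t)
tsub-cong {f} {g} e (tlam w t) = cong₂ tlam (tsub-cong e w) (tsub-cong e' t)
  where e' : exts f ≗ exts g
        e' zero = refl
        e' (suc i) = cong tlift (e i)
tsub-cong e (tcast u t) = cong₂ tcast (tsub-cong e u) (tsub-cong e t)
tsub-cong e (tkeep u t) = cong₂ tkeep (tsub-cong e u) (tsub-cong e t)

tren-tren : ∀ f g t → tren f (tren g t) ≡ tren (λ i → f (g i)) t
tren-tren f g tsort = refl
tren-tren f g (tvar i) = refl
tren-tren f g (tapp u t) = cong₂ tapp (tren-tren f g u) (tren-tren f g t)
tren-tren f g (tlam w t) = cong₂ tlam (tren-tren f g w)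
  (trans (tren-tren (ext f) (ext g) t) (tren-cong e t))
  where e : (λ i → ext f (ext g i)) ≗ ext (λ i → f (g i))
        e zero = refl
        e (suc i) = refl
tren-tren f g (tcast u t) = cong₂ tcast (tren-tren f g u) (tren-tren f g t)
tren-tren f g (tkeep u t) = cong₂ tkeep (tren-tren f g u) (tren-tren f g t)

tsub-tren : ∀ ρ g t → tsub ρ (tren g t) ≡ tsub (λ i → ρ (g i)) t
tsub-tren ρ g tsort = refl
tsub-tren ρ g (tvar i) = refl
tsub-tren ρ g (tapp u t) = cong₂ tapp (tsub-tren ρ g u) (tsub-tren ρ g t)
tsub-tren ρ g (tlam w t) = cong₂ tlam (tsub-tren ρ g w)
  (trans (tsub-tren (exts ρ) (ext g) t) (tsub-cong e t))
  where e : (λ i → exts ρ (ext g i)) ≗ exts (λ i → ρ (g i))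
        e zero = refl
        e (suc i) = refl
tsub-tren ρ g (tcast u t) = cong₂ tcast (tsub-tren ρ g u) (tsub-tren ρ g t)
tsub-tren ρ g (tkeep u t) = cong₂ tkeep (tsub-tren ρ g u) (tsub-tren ρ g t)

tren-tsub : ∀ f ρ t → tren f (tsub ρ t) ≡ tsub (λ i → tren f (ρ i)) t
tren-tsub f ρ tsort = refl
tren-tsub f ρ (tvar i) = refl
tren-tsub f ρ (tapp u t) = cong₂ tapp (tren-tsub f ρ u) (tren-tsub f ρ t)
tren-tsub f ρ (tlam w t) = cong₂ tlam (tren-tsub f ρ w)
  (trans (tren-tsub (ext f) (exts ρ) t) (tsub-cong e t))
  where e : (λ i → tren (ext f) (exts ρ i)) ≗ exts (λ i → tren f (ρ i))
        e zero = refl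
        e (suc i) = trans (tren-tren (ext f) suc (ρ i)) (sym (tren-tren suc f (ρ i)))
tren-tsub f ρ (tcast u t) = cong₂ tcast (tren-tsub f ρ u) (tren-tsub f ρ t)
tren-tsub f ρ (tkeep u t) = cong₂ tkeep (tren-tsub f ρ u) (tren-tsub f ρ t)

tsub-tsub : ∀ ρ τ t → tsub ρ (tsub τ t) ≡ tsub (λ i → tsub ρ (τ i)) t
tsub-tsub ρ τ tsort = refl
tsub-tsub ρ τ (tvar i) = refl
tsub-tsub ρ τ (tapp u t) = cong₂ tapp (tsub-tsub ρ τ u) (tsub-tsub ρ τ t)
tsub-tsub ρ τ (tlam w t) = cong₂ tlam (tsub-tsub ρ τ w)
  (trans (tsub-tsub (exts ρ) (exts τ) t) (tsub-cong e t))
  where e : (λ i → tsub (exts ρ) (exts τ i)) ≗ exts (λ i → tsub ρ (τ i))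
        e zero = refl
        e (suc i) = trans (tsub-tren (exts ρ) suc (τ i)) (sym (tren-tsub suc ρ (τ i)))
tsub-tsub ρ τ (tcast u t) = cong₂ tcast (tsub-tsub ρ τ u) (tsub-tsub ρ τ t)
tsub-tsub ρ τ (tkeep u t) = cong₂ tkeep (tsub-tsub ρ τ u) (tsub-tsub ρ τ t)

tsub-id : ∀ t → tsub tvar t ≡ t
tsub-id tsort = refl
tsub-id (tvar i) = refl
tsub-id (tapp u t) = cong₂ tapp (tsub-id u) (tsub-id t)
tsub-id (tlam w t) = cong₂ tlam (tsub-id w) (trans (tsub-cong e t) (tsub-id t))
  where e : exts tvar ≗ tvar
        e zero = refl
        e (suc i) = refl
tsub-id (tcast u t) = cong₂ tcast (tsub-id u) (tsub-id t)
tsub-id (tkeep u t) = cong₂ tkeep (tsub-id u) (tsub-id t)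

sub1 : TT → TT → TT
sub1 c t = tsub (c ∷ᶠ tvar) t

sub1-lift : ∀ c t → sub1 c (tlift t) ≡ t
sub1-lift c t = trans (tsub-tren (c ∷ᶠ tvar) suc t) (tsub-id t)

tsub-sub1 : ∀ ρ c t → tsub ρ (sub1 c t) ≡ sub1 (tsub ρ c) (tsub (exts ρ) t)
tsub-sub1 ρ c t = trans (tsub-tsub ρ (c ∷ᶠ tvar) t)
  (trans (tsub-cong e t) (sym (tsub-tsub (tsub ρ c ∷ᶠ tvar) (exts ρ) t)))
  where e : (λ i → tsub ρ ((c ∷ᶠ tvar) i)) ≗ (λ i → tsub (tsub ρ c ∷ᶠ tvar) (exts ρ i))
        e zero = refl
        e (suc i) = sym (sub1-lift (tsub ρ c) (ρ i))

tren-sub1 : ∀ f c t → tren f (sub1 c t) ≡ sub1 (tren f c) (tren (ext f) t)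
tren-sub1 f c t = trans (tren-tsub f (c ∷ᶠ tvar) t)
  (trans (tsub-cong e t) (sym (tsub-tren (tren f c ∷ᶠ tvar) (ext f) t)))
  where e : (λ i → tren f ((c ∷ᶠ tvar) i)) ≗ (λ i → (tren f c ∷ᶠ tvar) (ext f i))
        e zero = refl
        e (suc i) = refl

-- The parameter γ maps each variable to
-- its declared type term, to which the variable may step (the target
-- counterpart of the rule K,x:W ⊢ x → W); under a binder λ:w the new
-- variable expands to w.

extExp : TT → (ℕ → TT) → ℕ → TT
extExp w γ = tlift w ∷ᶠ (λ i → tlift (γ i))

data Red : (ℕ → TT) → TT → TT → Set where
  t-var   : ∀ {γ i} → Red γ (tvar i) (γ i)
  t-beta  : ∀ {γ u w t} → Red γ (tapp u (tlam w t)) (tkeep (sub1 (tcast w u) t) (tcast w u))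
  t-theta : ∀ {γ u t v} → Red γ (tapp u (tkeep t v)) (tkeep (tapp u t) v)
  t-zeta  : ∀ {γ t v} → Red γ (tkeep t v) t
  t-eps   : ∀ {γ u t} → Red γ (tcast u t) t
  t-ee    : ∀ {γ u t} → Red γ (tcast u t) u
  t-appL  : ∀ {γ u u' t} → Red γ u u' → Red γ (tapp u t) (tapp u' t)
  t-appR  : ∀ {γ u t t'} → Red γ t t' → Red γ (tapp u t) (tapp u t')
  t-lamW  : ∀ {γ w w' t} → Red γ w w' → Red γ (tlam w t) (tlam w' t)
  t-lamT  : ∀ {γ w t t'} → Red (extExp w γ) t t' → Red γ (tlam w t) (tlam w t')
  t-castU : ∀ {γ u u' t} → Red γ u u' → Red γ (tcast u t) (tcast u' t)
  t-castT : ∀ {γ u t t'} → Red γ t t' → Red γ (tcast u t) (tcast u t')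
  t-keepT : ∀ {γ t t' v} → Red γ t t' → Red γ (tkeep t v) (tkeep t' v)
  t-keepV : ∀ {γ t v v'} → Red γ v v' → Red γ (tkeep t v) (tkeep t v')

RenRespects : (ℕ → ℕ) → (ℕ → TT) → (ℕ → TT) → Set
RenRespects f γ δ = ∀ i → δ (f i) ≡ tren f (γ i)

renRespects-ext : ∀ {f γ δ} w → RenRespects f γ δ →
                  RenRespects (ext f) (extExp w γ) (extExp (tren f w) δ)
renRespects-ext {f} w ok zero = trans (tren-tren suc f w) (sym (tren-tren (ext f) suc w))
renRespects-ext {f} {γ} w ok (suc i) = trans (cong tlift (ok i))
  (trans (tren-tren suc f (γ i)) (sym (tren-tren (ext f) suc (γ i))))

tren-red : ∀ {f γ δ t t'} → RenRespects f γ δ → Red γ t t' → Red δ (tren f t) (tren f t')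
tren-red {f} ok (t-var {i = i}) = subst (Red _ (tvar (f i))) (ok i) t-var
tren-red {f} ok (t-beta {u = u} {w} {t}) =
  subst (Red _ _) (cong (λ z → tkeep z (tcast (tren f w) (tren f u))) (sym (tren-sub1 f (tcast w u) t))) t-beta
tren-red ok t-theta = t-theta
tren-red ok t-zeta = t-zeta
tren-red ok t-eps = t-eps
tren-red ok t-ee = t-ee
tren-red ok (t-appL r) = t-appL (tren-red ok r)
tren-red ok (t-appR r) = t-appR (tren-red ok r)
tren-red ok (t-lamW r) = t-lamW (tren-red ok r)
tren-red ok (t-lamT {w = w} r) = t-lamT (tren-red (renRespects-ext w ok) r)
tren-red ok (t-castU r) = t-castU (tren-red ok r)
tren-red ok (t-castT r) = t-castT (tren-red ok r)
tren-red ok (t-keepT r) = t-keepT (tren-red ok r)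
tren-red ok (t-keepV r) = t-keepV (tren-red ok r)

lift-star : ∀ {γ t t'} w → Star (Red γ) t t' → Star (Red (extExp w γ)) (tlift t) (tlift t')
lift-star w = gmap tlift (tren-red (λ i → refl))

lift-plus : ∀ {γ t t'} w → Plus (Red γ) t t' → Plus (Red (extExp w γ)) (tlift t) (tlift t')
lift-plus w = plus-map tlift (tren-red (λ i → refl))

SubRespects : (ℕ → TT) → (ℕ → TT) → (ℕ → TT) → Set
SubRespects ρ γ δ = ∀ i → Plus (Red δ) (ρ i) (tsub ρ (γ i))

subRespects-ext : ∀ {ρ γ δ} w → SubRespects ρ γ δ →
                  SubRespects (exts ρ) (extExp w γ) (extExp (tsub ρ w) δ)
subRespects-ext {ρ} w ok zero = subst (Plus _ _) e [ t-var ]⁺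
  where e : tlift (tsub ρ w) ≡ tsub (exts ρ) (tlift w)
        e = trans (tren-tsub suc ρ w) (sym (tsub-tren (exts ρ) suc w))
subRespects-ext {ρ} {γ} w ok (suc i) = subst (Plus _ _) e (lift-plus (tsub ρ w) (ok i))
  where e : tlift (tsub ρ (γ i)) ≡ tsub (exts ρ) (tlift (γ i))
        e = trans (tren-tsub suc ρ (γ i)) (sym (tsub-tren (exts ρ) suc (γ i)))

tsub-red : ∀ {ρ γ δ t t'} → SubRespects ρ γ δ → Red γ t t' → Plus (Red δ) (tsub ρ t) (tsub ρ t')
tsub-red ok (t-var {i = i}) = ok i
tsub-red {ρ} ok (t-beta {u = u} {w} {t}) =
  [ subst (Red _ _) (cong (λ z → tkeep z (tcast (tsub ρ w) (tsub ρ u))) (sym (tsub-sub1 ρ (tcast w u) t))) t-beta ]⁺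
tsub-red ok t-theta = [ t-theta ]⁺
tsub-red ok t-zeta = [ t-zeta ]⁺
tsub-red ok t-eps = [ t-eps ]⁺
tsub-red ok t-ee = [ t-ee ]⁺
tsub-red ok (t-appL r) = plus-map _ t-appL (tsub-red ok r)
tsub-red ok (t-appR r) = plus-map _ t-appR (tsub-red ok r)
tsub-red ok (t-lamW r) = plus-map _ t-lamW (tsub-red ok r)
tsub-red ok (t-lamT {w = w} r) = plus-map _ t-lamT (tsub-red (subRespects-ext w ok) r)
tsub-red ok (t-castU r) = plus-map _ t-castU (tsub-red ok r)
tsub-red ok (t-castT r) = plus-map _ t-castT (tsub-red ok r)
tsub-red ok (t-keepT r) = plus-map _ t-keepT (tsub-red ok r)
tsub-red ok (t-keepV r) = plus-map _ t-keepV (tsub-red ok r)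

tsub-pointwise : ∀ {δ ρ ρ'} → (∀ i → Star (Red δ) (ρ i) (ρ' i)) → ∀ t →
                 Star (Red δ) (tsub ρ t) (tsub ρ' t)
tsub-pointwise h tsort = ε
tsub-pointwise h (tvar i) = h i
tsub-pointwise h (tapp u t) = gmap _ t-appL (tsub-pointwise h u) ◅◅ gmap _ t-appR (tsub-pointwise h t)
tsub-pointwise {δ} {ρ} {ρ'} h (tlam w t) =
  gmap _ t-lamW (tsub-pointwise h w) ◅◅ gmap _ t-lamT (tsub-pointwise h' t)
  where h' : ∀ i → Star (Red (extExp (tsub ρ' w) δ)) (exts ρ i) (exts ρ' i)
        h' zero = ε
        h' (suc i) = lift-star (tsub ρ' w) (h i)
tsub-pointwise h (tcast u t) = gmap _ t-castU (tsub-pointwise h u) ◅◅ gmap _ t-castT (tsub-pointwise h t)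
tsub-pointwise h (tkeep u t) = gmap _ t-keepT (tsub-pointwise h u) ◅◅ gmap _ t-keepV (tsub-pointwise h t)

sub1-pointwise : ∀ {δ c c'} → Star (Red δ) c c' → ∀ t → Star (Red δ) (sub1 c t) (sub1 c' t)
sub1-pointwise {δ} {c} {c'} c⟶c' = tsub-pointwise pointwise
  where pointwise : ∀ i → Star (Red δ) ((c ∷ᶠ tvar) i) ((c' ∷ᶠ tvar) i)
        pointwise zero = c⟶c'
        pointwise (suc i) = ε

-- Strong normalization of typed target terms (Tait's method).  We work
-- with the expansion γ₀ sending every variable to a sort; this is all that
-- closed source terms need.

data Ty : Set where
  ι   : Ty
  _⇒_ : Ty → Ty → Ty

γ₀ : ℕ → TT
γ₀ _ = tsort

SNᵗ : TT → Set
SNᵗ = SNᴿ (Red γ₀)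

Reducible : Ty → TT → Set
Reducible ι t = SNᵗ t
Reducible (ρ ⇒ τ) t = ∀ u → Reducible ρ u → Reducible τ (tapp u t)

Neutral : TT → Set
Neutral (tlam _ _) = ⊥
Neutral (tkeep _ _) = ⊥
Neutral _ = ⊤

sn-appR : ∀ {u t} → SNᵗ (tapp u t) → SNᵗ t
sn-appR (acc h) = acc λ r → sn-appR (h (t-appR r))

mutual
  reducible⇒sn : ∀ σ {t} → Reducible σ t → SNᵗ t
  reducible⇒sn ι r = r
  reducible⇒sn (ρ ⇒ τ) r = sn-appR (reducible⇒sn τ (r tsort (sort-reducible ρ)))

  sort-reducible : ∀ ρ → Reducible ρ tsort
  sort-reducible ρ = neutral-reducible ρ tt λ ()

  reducible-red : ∀ σ {t t'} → Reducible σ t → Red γ₀ t t' → Reducible σ t'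
  reducible-red ι (acc h) r = h r
  reducible-red (ρ ⇒ τ) f r u ru = reducible-red τ (f u ru) (t-appR r)

  neutral-reducible : ∀ σ {t} → Neutral t → (∀ {t'} → Red γ₀ t t' → Reducible σ t') → Reducible σ t
  neutral-reducible ι n h = acc h
  neutral-reducible (ρ ⇒ τ) {t} n h u ru = go ru (reducible⇒sn ρ ru)
    where go : ∀ {u} → Reducible ρ u → SNᵗ u → Reducible τ (tapp u t)
          go ru (acc hu) = neutral-reducible τ tt λ
            { (t-appL r) → go (reducible-red ρ ru r) (hu r)
            ; (t-appR r) → h r _ ru
            ; t-beta → ⊥-elim n
            ; t-theta → ⊥-elim n }

reducible-red* : ∀ σ {t t'} → Reducible σ t → Star (Red γ₀) t t' → Reducible σ t'
reducible-red* σ r ε = r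
reducible-red* σ r (x ◅ s) = reducible-red* σ (reducible-red σ r x) s

reducible-cast : ∀ σ {u t} → Reducible σ u → Reducible σ t → Reducible σ (tcast u t)
reducible-cast σ ru rt = go ru rt (reducible⇒sn σ ru) (reducible⇒sn σ rt)
  where go : ∀ {u t} → Reducible σ u → Reducible σ t → SNᵗ u → SNᵗ t → Reducible σ (tcast u t)
        go ru rt (acc hu) (acc ht) = neutral-reducible σ tt λ
          { t-eps → rt
          ; t-ee → ru
          ; (t-castU r) → go (reducible-red σ ru r) rt (hu r) (acc ht)
          ; (t-castT r) → go ru (reducible-red σ rt r) (acc hu) (ht r) }

sn-keep : ∀ {t v} → SNᵗ t → SNᵗ v → SNᵗ (tkeep t v)
sn-keep (acc ht) (acc hv) = acc λ
  { t-zeta → acc ht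
  ; (t-keepT r) → sn-keep (ht r) (acc hv)
  ; (t-keepV r) → sn-keep (acc ht) (hv r) }

reducible-keep : ∀ σ {t v} → Reducible σ t → SNᵗ v → Reducible σ (tkeep t v)
reducible-keep ι rt sv = sn-keep rt sv
reducible-keep (ρ ⇒ τ) {t} {v} rt sv u ru =
  go ru rt (reducible⇒sn ρ ru) (reducible⇒sn (ρ ⇒ τ) rt) sv
  where go : ∀ {u t v} → Reducible ρ u → Reducible (ρ ⇒ τ) t → SNᵗ u → SNᵗ t → SNᵗ v →
             Reducible τ (tapp u (tkeep t v))
        go ru rt (acc hu) (acc ht) (acc hv) = neutral-reducible τ tt λ
          { (t-appL r) → go (reducible-red ρ ru r) rt (hu r) (acc ht) (acc hv)
          ; (t-appR (t-keepT r)) → go ru (reducible-red (ρ ⇒ τ) rt r) (acc hu) (ht r) (acc hv)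
          ; (t-appR (t-keepV r)) → go ru rt (acc hu) (acc ht) (hv r)
          ; (t-appR t-zeta) → rt _ ru
          ; t-theta → reducible-keep τ (rt _ ru) (acc hv) }

-- Under the β-substitution [x := tcast w u] the bound variable expands to
-- w in one ee-step, so body reductions survive the substitution.
cast-sub-respects : ∀ w u → SubRespects (tcast w u ∷ᶠ tvar) (extExp w γ₀) γ₀
cast-sub-respects w u zero = subst (Plus _ _) (sym (sub1-lift (tcast w u) w)) [ t-ee ]⁺
cast-sub-respects w u (suc i) = [ t-var ]⁺

-- An abstraction is normalizing when its type and its body, instantiated by
-- a cast, are: its steps are simulated by those of tkeep (body[cast]) w.
sn-lam : ∀ {w t} → SNᵗ w → SNᵗ (sub1 (tcast w tsort) t) → SNᵗ (tlam w t)
sn-lam {w} {t} sw sb = components⇒sn (sn-simulation instantiate simulate (sn-keep sb sw) ε)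
  where
  LamStep : TT × TT → TT × TT → Set
  LamStep (w , t) (w' , t') = Red γ₀ (tlam w t) (tlam w' t')

  instantiate : TT × TT → TT
  instantiate (w , t) = tkeep (sub1 (tcast w tsort) t) w

  simulate : ∀ {a a'} → LamStep a a' → Plus (Red γ₀) (instantiate a) (instantiate a')
  simulate {w , t} (t-lamW r) = t-keepV r ◅⁺ gmap _ t-keepT (sub1-pointwise (t-castU r ◅ ε) t)
  simulate {w , t} (t-lamT r) = plus-map _ t-keepT (tsub-red (cast-sub-respects w tsort) r)

  components⇒sn : ∀ {w t} → SNᴿ LamStep (w , t) → SNᵗ (tlam w t)
  components⇒sn (acc h) = acc λ
    { (t-lamW r) → components⇒sn (h (t-lamW r))
    ; (t-lamT r) → components⇒sn (h (t-lamT r)) }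

ReducibleBody : Ty → Ty → TT → TT → Set
ReducibleBody ρ τ w t = ∀ u → Reducible ρ u → Reducible τ (sub1 (tcast w u) t)

reducible-lam : ∀ ρ τ {w t} → Reducible ρ w → ReducibleBody ρ τ w t → Reducible (ρ ⇒ τ) (tlam w t)
reducible-lam ρ τ {w} {t} rw body u ru =
  go ru rw body (reducible⇒sn ρ ru) (sn-lam (reducible⇒sn ρ rw) (reducible⇒sn τ (body tsort (sort-reducible ρ))))
  where
  go : ∀ {u w t} → Reducible ρ u → Reducible ρ w → ReducibleBody ρ τ w t → SNᵗ u → SNᵗ (tlam w t) →
       Reducible τ (tapp u (tlam w t))
  go {u} {w} {t} ru rw body (acc hu) (acc hl) = neutral-reducible τ tt λ
    { (t-appL r) → go (reducible-red ρ ru r) rw body (hu r) (acc hl)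
    ; (t-appR (t-lamW r)) →
        go ru (reducible-red ρ rw r)
           (λ u' ru' → reducible-red* τ (body u' ru') (sub1-pointwise (t-castU r ◅ ε) t))
           (acc hu) (hl (t-lamW r))
    ; (t-appR (t-lamT r)) →
        go ru rw (λ u' ru' → reducible-red* τ (body u' ru') (plus⇒star (tsub-red (cast-sub-respects w u') r)))
           (acc hu) (hl (t-lamT r))
    ; t-beta → reducible-keep τ (body u ru) (reducible⇒sn ρ (reducible-cast ρ rw ru)) }

data Typ : (ℕ → Ty) → TT → Ty → Set where
  ty-sort : ∀ {Δ} → Typ Δ tsort ι
  ty-var  : ∀ {Δ i} → Typ Δ (tvar i) (Δ i)
  ty-app  : ∀ {Δ u t ρ τ} → Typ Δ u ρ → Typ Δ t (ρ ⇒ τ) → Typ Δ (tapp u t) τ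
  ty-lam  : ∀ {Δ w t ρ τ} → Typ Δ w ρ → Typ (ρ ∷ᶠ Δ) t τ → Typ Δ (tlam w t) (ρ ⇒ τ)
  ty-cast : ∀ {Δ u t σ} → Typ Δ u σ → Typ Δ t σ → Typ Δ (tcast u t) σ
  ty-keep : ∀ {Δ t v σ ρ} → Typ Δ t σ → Typ Δ v ρ → Typ Δ (tkeep t v) σ

Typ-ren : ∀ {Δ Δ' f t ρ} → (∀ i → Δ' (f i) ≡ Δ i) → Typ Δ t ρ → Typ Δ' (tren f t) ρ
Typ-ren e ty-sort = ty-sort
Typ-ren {Δ' = Δ'} {f} e (ty-var {i = i}) = subst (Typ Δ' (tvar (f i))) (e i) ty-var
Typ-ren e (ty-app d d₁) = ty-app (Typ-ren e d) (Typ-ren e d₁)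
Typ-ren {Δ} {Δ'} {f} e (ty-lam {ρ = ρ} d d₁) = ty-lam (Typ-ren e d) (Typ-ren e' d₁)
  where e' : ∀ i → (ρ ∷ᶠ Δ') (ext f i) ≡ (ρ ∷ᶠ Δ) i
        e' zero = refl
        e' (suc i) = e i
Typ-ren e (ty-cast d d₁) = ty-cast (Typ-ren e d) (Typ-ren e d₁)
Typ-ren e (ty-keep d d₁) = ty-keep (Typ-ren e d) (Typ-ren e d₁)

fundamental : ∀ {Δ t σ} → Typ Δ t σ → ∀ {ρs} → (∀ i → Reducible (Δ i) (ρs i)) → Reducible σ (tsub ρs t)
fundamental ty-sort h = sort-reducible ι
fundamental (ty-var {i = i}) h = h i
fundamental (ty-app du dt) h = fundamental dt h _ (fundamental du h)
fundamental (ty-lam {w = w} {t} {ρ} {τ} dw dt) {ρs} h =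
  reducible-lam ρ τ (fundamental dw h) λ u ru → subst (Reducible τ) (instance≡ u) (fundamental dt (h' u ru))
  where
  h' : ∀ u → Reducible ρ u → ∀ i → Reducible ((ρ ∷ᶠ _) i) ((tcast (tsub ρs w) u ∷ᶠ ρs) i)
  h' u ru zero = reducible-cast ρ (fundamental dw h) ru
  h' u ru (suc i) = h i
  instance≡ : ∀ u → tsub (tcast (tsub ρs w) u ∷ᶠ ρs) t ≡ sub1 (tcast (tsub ρs w) u) (tsub (exts ρs) t)
  instance≡ u = trans (tsub-cong e t) (sym (tsub-tsub (tcast (tsub ρs w) u ∷ᶠ tvar) (exts ρs) t))
    where e : (tcast (tsub ρs w) u ∷ᶠ ρs) ≗ (λ i → tsub (tcast (tsub ρs w) u ∷ᶠ tvar) (exts ρs i))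
          e zero = refl
          e (suc i) = sym (sub1-lift _ (ρs i))
fundamental (ty-cast du dt) h = reducible-cast _ (fundamental du h) (fundamental dt h)
fundamental (ty-keep dt dv) h = reducible-keep _ (fundamental dt h) (reducible⇒sn _ (fundamental dv h))

typed⇒sn : ∀ {t σ} → Typ (λ _ → ι) t σ → SNᵗ t
typed⇒sn {t} {σ} d =
  subst SNᵗ (tsub-id t) (reducible⇒sn σ (fundamental d {tvar} λ i → acc λ { t-var → acc λ () }))

module Source (S : Set) (next : S → S) where
  open System S next

  ren : (ℕ → ℕ) → Term → Term
  ren f (sort s) = sort s
  ren f (lref i) = lref (f i)
  ren f (app V T) = app (ren f V) (ren f T)
  ren f (bind b V T) = bind b (ren f V) (ren (ext f) T)
  ren f (cast U T) = cast (ren f U) (ren f T)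

  ren-cong : ∀ {f g} → f ≗ g → ∀ T → ren f T ≡ ren g T
  ren-cong e (sort s) = refl
  ren-cong e (lref i) = cong lref (e i)
  ren-cong e (app V T) = cong₂ app (ren-cong e V) (ren-cong e T)
  ren-cong {f} {g} e (bind b V T) = cong₂ (bind b) (ren-cong e V) (ren-cong e' T)
    where e' : ext f ≗ ext g
          e' zero = refl
          e' (suc i) = cong suc (e i)
  ren-cong e (cast V T) = cong₂ cast (ren-cong e V) (ren-cong e T)

  ren-id : ∀ {f} → (∀ i → f i ≡ i) → ∀ T → ren f T ≡ T
  ren-id e (sort s) = refl
  ren-id e (lref i) = cong lref (e i)
  ren-id e (app V T) = cong₂ app (ren-id e V) (ren-id e T)
  ren-id {f} e (bind b V T) = cong₂ (bind b) (ren-id e V) (ren-id e' T)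
    where e' : ∀ i → ext f i ≡ i
          e' zero = refl
          e' (suc i) = cong suc (e i)
  ren-id e (cast V T) = cong₂ cast (ren-id e V) (ren-id e T)

  ren-ren : ∀ f g T → ren f (ren g T) ≡ ren (λ i → f (g i)) T
  ren-ren f g (sort s) = refl
  ren-ren f g (lref i) = refl
  ren-ren f g (app V T) = cong₂ app (ren-ren f g V) (ren-ren f g T)
  ren-ren f g (bind b V T) = cong₂ (bind b) (ren-ren f g V)
    (trans (ren-ren (ext f) (ext g) T) (ren-cong e T))
    where e : (λ i → ext f (ext g i)) ≗ ext (λ i → f (g i))
          e zero = refl
          e (suc i) = refl
  ren-ren f g (cast V T) = cong₂ cast (ren-ren f g V) (ren-ren f g T)

  liftIndex : ℕ → ℕ → ℕ
  liftIndex d i = if i <ᵇ d then i else suc i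

  liftIndex-suc : ∀ d → liftIndex (suc d) ≗ ext (liftIndex d)
  liftIndex-suc d zero = refl
  liftIndex-suc d (suc i) with i <ᵇ d
  ... | true = refl
  ... | false = refl

  lift≡ren : ∀ d T → lift d T ≡ ren (liftIndex d) T
  lift≡ren d (sort s) = refl
  lift≡ren d (lref i) with i <ᵇ d
  ... | true = refl
  ... | false = refl
  lift≡ren d (app V T) = cong₂ app (lift≡ren d V) (lift≡ren d T)
  lift≡ren d (bind b V T) = cong₂ (bind b) (lift≡ren d V)
    (trans (lift≡ren (suc d) T) (ren-cong (liftIndex-suc d) T))
  lift≡ren d (cast V T) = cong₂ cast (lift≡ren d V) (lift≡ren d T)

  lift0 : ∀ T → lift 0 T ≡ ren suc T
  lift0 T = lift≡ren 0 T

  unlift : ∀ T → ren pred (lift 0 T) ≡ T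
  unlift T = trans (cong (ren pred) (lift0 T)) (trans (ren-ren pred suc T) (ren-id (λ i → refl) T))

  lift-ren : ∀ f T → ren (ext f) (lift 0 T) ≡ lift 0 (ren f T)
  lift-ren f T = trans (cong (ren (ext f)) (lift0 T))
    (trans (ren-ren (ext f) suc T) (trans (sym (ren-ren suc f T)) (sym (lift0 (ren f T)))))

  ≈-refl : ∀ T → T ≈ T
  ≈-refl (sort s) = ≈-sort
  ≈-refl (lref i) = ≈-lref
  ≈-refl (app V T) = ≈-app (≈-refl V) (≈-refl T)
  ≈-refl (bind b V T) = ≈-bind (≈-refl V) (≈-refl T)
  ≈-refl (cast V T) = ≈-cast (≈-refl V) (≈-refl T)

  ≈-ren : ∀ f {T T'} → T ≈ T' → ren f T ≈ ren f T'
  ≈-ren f ≈-sort = ≈-sort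
  ≈-ren f ≈-lref = ≈-lref
  ≈-ren f (≈-bind p q) = ≈-bind (≈-ren f p) (≈-ren (ext f) q)
  ≈-ren f (≈-app p q) = ≈-app (≈-ren f p) (≈-ren f q)
  ≈-ren f (≈-cast p q) = ≈-cast (≈-ren f p) (≈-ren f q)

  ≈-unlift : ∀ T T' → lift 0 T ≈ lift 0 T' → T ≈ T'
  ≈-unlift T T' p = subst₂ _≈_ (unlift T) (unlift T') (≈-ren pred p)

  RenCompatible : (ℕ → ℕ) → Env → Env → Set
  RenCompatible f L L' = ∀ {i T} → L ⊢ lref i ⤳ T → L' ⊢ lref (f i) ⤳ ren f T

  ren-⤳ : ∀ {f L L' T T'} → RenCompatible f L L' → L ⊢ T ⤳ T' → L' ⊢ ren f T ⤳ ren f T'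
  ren-⤳ h x-beta = x-beta
  ren-⤳ {f} h (x-theta {V = V}) rewrite lift-ren f V = x-theta
  ren-⤳ h x-lref0 = h x-lref0
  ren-⤳ {f} h (x-zeta {T = T}) rewrite lift-ren f T = x-zeta
  ren-⤳ h x-eps = x-eps
  ren-⤳ h x-sort = x-sort
  ren-⤳ h x-ee = x-ee
  ren-⤳ h (x-lref r) = h (x-lref r)
  ren-⤳ h (x-appV r) = x-appV (ren-⤳ h r)
  ren-⤳ h (x-bindV r) = x-bindV (ren-⤳ h r)
  ren-⤳ h (x-castU r) = x-castU (ren-⤳ h r)
  ren-⤳ h (x-appT r) = x-appT (ren-⤳ h r)
  ren-⤳ h (x-castT r) = x-castT (ren-⤳ h r)
  ren-⤳ {f} h (x-bindT {V = V} r) = x-bindT (ren-⤳ h' r)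
    where h' : RenCompatible (ext f) (snoc _ _ V) (snoc _ _ (ren f V))
          h' (x-lref0 {V = V}) rewrite lift-ren f V = x-lref0
          h' (x-lref {T = T} r) rewrite lift-ren f T = x-lref (h r)

  lift-⤳ : ∀ {L T T' b X} → L ⊢ T ⤳ T' → snoc L b X ⊢ lift 0 T ⤳ lift 0 T'
  lift-⤳ {T = T} {T'} r = subst₂ (λ a c → _ ⊢ a ⤳ c) (sym (lift0 T)) (sym (lift0 T'))
    (ren-⤳ (λ {i} {T₀} r₀ → subst (λ z → _ ⊢ _ ⤳ z) (lift0 T₀) (x-lref r₀)) r)

  Ctx : Set
  Ctx = ℕ → Maybe Ty

  data Skel : Ctx → Term → Ty → Set where
    sk-sort : ∀ {Γ s} → Skel Γ (sort s) ι
    sk-lref : ∀ {Γ i σ} → Γ i ≡ just σ → Skel Γ (lref i) σ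
    sk-app  : ∀ {Γ V T ρ τ} → Skel Γ V ρ → Skel Γ T (ρ ⇒ τ) → Skel Γ (app V T) τ
    sk-abst : ∀ {Γ W T ρ τ} → Skel Γ W ρ → Skel (just ρ ∷ᶠ Γ) T τ → Skel Γ (bind abst W T) (ρ ⇒ τ)
    sk-abbr : ∀ {Γ V T ρ τ} → Skel Γ V ρ → Skel (just ρ ∷ᶠ Γ) T τ → Skel Γ (bind abbr V T) τ
    sk-cast : ∀ {Γ U T σ} → Skel Γ U σ → Skel Γ T σ → Skel Γ (cast U T) σ

  _⟶ᶜ_[_] : Ctx → Ctx → (ℕ → ℕ) → Set
  Γ ⟶ᶜ Γ' [ f ] = ∀ i → Γ' (f i) ≡ Γ i

  ctx-ext : ∀ {Γ Γ' f} m → Γ ⟶ᶜ Γ' [ f ] → (m ∷ᶠ Γ) ⟶ᶜ (m ∷ᶠ Γ') [ ext f ]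
  ctx-ext m e zero = refl
  ctx-ext m e (suc i) = e i

  Skel-ren : ∀ {Γ Γ' f T σ} → Skel Γ T σ → Γ ⟶ᶜ Γ' [ f ] → Skel Γ' (ren f T) σ
  Skel-ren sk-sort e = sk-sort
  Skel-ren (sk-lref {i = i} x) e = sk-lref (trans (e i) x)
  Skel-ren (sk-app d d₁) e = sk-app (Skel-ren d e) (Skel-ren d₁ e)
  Skel-ren (sk-abst d d₁) e = sk-abst (Skel-ren d e) (Skel-ren d₁ (ctx-ext _ e))
  Skel-ren (sk-abbr d d₁) e = sk-abbr (Skel-ren d e) (Skel-ren d₁ (ctx-ext _ e))
  Skel-ren (sk-cast d d₁) e = sk-cast (Skel-ren d e) (Skel-ren d₁ e)

  Skel-unren : ∀ {Γ Γ' f σ} T → Skel Γ' (ren f T) σ → Γ ⟶ᶜ Γ' [ f ] → Skel Γ T σ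
  Skel-unren (sort s) sk-sort e = sk-sort
  Skel-unren (lref i) (sk-lref x) e = sk-lref (trans (sym (e i)) x)
  Skel-unren (app V T) (sk-app d d₁) e = sk-app (Skel-unren V d e) (Skel-unren T d₁ e)
  Skel-unren (bind abst V T) (sk-abst d d₁) e = sk-abst (Skel-unren V d e) (Skel-unren T d₁ (ctx-ext _ e))
  Skel-unren (bind abbr V T) (sk-abbr d d₁) e = sk-abbr (Skel-unren V d e) (Skel-unren T d₁ (ctx-ext _ e))
  Skel-unren (cast V T) (sk-cast d d₁) e = sk-cast (Skel-unren V d e) (Skel-unren T d₁ e)

  Skel-lift : ∀ {Γ T σ} → Skel (λ i → Γ (suc i)) T σ → Skel Γ (lift 0 T) σ
  Skel-lift {T = T} d rewrite lift0 T = Skel-ren d (λ i → refl)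

  Skel-unlift : ∀ {Γ T σ} → Skel Γ (lift 0 T) σ → Skel (λ i → Γ (suc i)) T σ
  Skel-unlift {T = T} d rewrite lift0 T = Skel-unren T d (λ i → refl)

  _≤ᶜ_ : Ctx → Ctx → Set
  Γ ≤ᶜ Γ' = ∀ i {x} → Γ i ≡ just x → Γ' i ≡ just x

  ≤ᶜ-ext : ∀ {Γ Γ'} m → Γ ≤ᶜ Γ' → (m ∷ᶠ Γ) ≤ᶜ (m ∷ᶠ Γ')
  ≤ᶜ-ext m le zero e = e
  ≤ᶜ-ext m le (suc i) e = le i e

  Skel-mono : ∀ {Γ Γ' T σ} → Skel Γ T σ → Γ ≤ᶜ Γ' → Skel Γ' T σ
  Skel-mono sk-sort le = sk-sort
  Skel-mono (sk-lref {i = i} x) le = sk-lref (le i x)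
  Skel-mono (sk-app d d₁) le = sk-app (Skel-mono d le) (Skel-mono d₁ le)
  Skel-mono (sk-abst d d₁) le = sk-abst (Skel-mono d le) (Skel-mono d₁ (≤ᶜ-ext _ le))
  Skel-mono (sk-abbr d d₁) le = sk-abbr (Skel-mono d le) (Skel-mono d₁ (≤ᶜ-ext _ le))
  Skel-mono (sk-cast d d₁) le = sk-cast (Skel-mono d le) (Skel-mono d₁ le)

  Compatible : Ctx → Ctx → Set
  Compatible Γ Γ' = ∀ i {a b} → Γ i ≡ just a → Γ' i ≡ just b → a ≡ b

  just-injective : ∀ {A : Set} {a b : A} → just a ≡ just b → a ≡ b
  just-injective refl = refl

  compatible-refl : ∀ Γ → Compatible Γ Γ
  compatible-refl Γ i e₁ e₂ = just-injective (trans (sym e₁) e₂)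

  compatible-ext : ∀ {Γ Γ' ρ} → Compatible Γ Γ' → Compatible (just ρ ∷ᶠ Γ) (just ρ ∷ᶠ Γ')
  compatible-ext c zero e₁ e₂ = just-injective (trans (sym e₁) e₂)
  compatible-ext c (suc i) e₁ e₂ = c i e₁ e₂

  ⇒-injectiveʳ : ∀ {a b c d} → (a ⇒ b) ≡ (c ⇒ d) → b ≡ d
  ⇒-injectiveʳ refl = refl

  Skel-unique : ∀ {Γ Γ' T a b} → Skel Γ T a → Skel Γ' T b → Compatible Γ Γ' → a ≡ b
  Skel-unique sk-sort sk-sort c = refl
  Skel-unique (sk-lref {i = i} x) (sk-lref x₁) c = c i x x₁
  Skel-unique (sk-app d d₁) (sk-app e e₁) c with Skel-unique d e c
  ... | refl = ⇒-injectiveʳ (Skel-unique d₁ e₁ c)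
  Skel-unique (sk-abst d d₁) (sk-abst e e₁) c with Skel-unique d e c
  ... | refl = cong (_ ⇒_) (Skel-unique d₁ e₁ (compatible-ext c))
  Skel-unique (sk-abbr d d₁) (sk-abbr e e₁) c with Skel-unique d e c
  ... | refl = Skel-unique d₁ e₁ (compatible-ext c)
  Skel-unique (sk-cast d d₁) (sk-cast e e₁) c = Skel-unique d e c

  EntrySkel : Ctx → Term → Maybe Ty → Set
  EntrySkel Γ V nothing = ⊤
  EntrySkel Γ V (just ρ) = Skel Γ V ρ

  data EnvSkel : Env → Ctx → Set where
    es-∅    : ∀ {Γ} → (∀ i → Γ i ≡ nothing) → EnvSkel ∅ Γ
    es-snoc : ∀ {Γ K b V} → EnvSkel K (λ i → Γ (suc i)) → EntrySkel (λ i → Γ (suc i)) V (Γ 0) →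
              EnvSkel (snoc K b V) Γ

  entry-skel : ∀ {Γ K b V σ} → EnvSkel (snoc K b V) Γ → Γ 0 ≡ just σ → Skel (λ i → Γ (suc i)) V σ
  entry-skel (es-snoc ok en) e = subst (EntrySkel _ _) e en

  subject-red : ∀ {L Γ T T' σ} → EnvSkel L Γ → Skel Γ T σ → L ⊢ T ⤳ T' → Skel Γ T' σ
  subject-red ok (sk-app sV (sk-abst sW sT)) x-beta = sk-abbr (sk-cast sW sV) sT
  subject-red ok (sk-app sV (sk-abbr sW sT)) x-theta = sk-abbr sW (sk-app (Skel-lift sV) sT)
  subject-red ok (sk-lref e) x-lref0 = Skel-lift (entry-skel ok e)
  subject-red ok (sk-abbr sV sT) x-zeta = Skel-unlift sT
  subject-red ok (sk-cast d d₁) x-eps = d₁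
  subject-red ok sk-sort x-sort = sk-sort
  subject-red ok (sk-cast d d₁) x-ee = d
  subject-red (es-snoc ok en) (sk-lref e) (x-lref r) = Skel-lift (subject-red ok (sk-lref e) r)
  subject-red ok (sk-app d d₁) (x-appV r) = sk-app (subject-red ok d r) d₁
  subject-red ok (sk-abst d d₁) (x-bindV r) = sk-abst (subject-red ok d r) d₁
  subject-red ok (sk-abbr d d₁) (x-bindV r) = sk-abbr (subject-red ok d r) d₁
  subject-red ok (sk-cast d d₁) (x-castU r) = sk-cast (subject-red ok d r) d₁
  subject-red ok (sk-app d d₁) (x-appT r) = sk-app d (subject-red ok d₁ r)
  subject-red ok (sk-cast d d₁) (x-castT r) = sk-cast d (subject-red ok d₁ r)
  subject-red ok (sk-abst d d₁) (x-bindT r) = sk-abst d (subject-red (es-snoc ok d) d₁ r)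
  subject-red ok (sk-abbr d d₁) (x-bindT r) = sk-abbr d (subject-red (es-snoc ok d) d₁ r)

  subject-red* : ∀ {L Γ T T' σ} → EnvSkel L Γ → Skel Γ T σ → Star (L ⊢_⤳_) T T' → Skel Γ T' σ
  subject-red* ok d ε = d
  subject-red* ok d (r ◅ s) = subject-red* ok (subject-red ok d r) s

  tr : (ℕ → TT) → Term → TT
  tr σ (sort s) = tsort
  tr σ (lref i) = σ i
  tr σ (app V T) = tapp (tr σ V) (tr σ T)
  tr σ (bind abst W T) = tlam (tr σ W) (tr (exts σ) T)
  tr σ (bind abbr V T) = tkeep (tr (tr σ V ∷ᶠ σ) T) (tr σ V)
  tr σ (cast V T) = tcast (tr σ V) (tr σ T)

  tr-cong : ∀ {σ σ'} → σ ≗ σ' → ∀ T → tr σ T ≡ tr σ' T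
  tr-cong e (sort s) = refl
  tr-cong e (lref i) = e i
  tr-cong e (app V T) = cong₂ tapp (tr-cong e V) (tr-cong e T)
  tr-cong {σ} {σ'} e (bind abst W T) = cong₂ tlam (tr-cong e W) (tr-cong e' T)
    where e' : exts σ ≗ exts σ'
          e' zero = refl
          e' (suc i) = cong tlift (e i)
  tr-cong {σ} {σ'} e (bind abbr V T) = cong₂ tkeep (tr-cong e' T) (tr-cong e V)
    where e' : (tr σ V ∷ᶠ σ) ≗ (tr σ' V ∷ᶠ σ')
          e' zero = tr-cong e V
          e' (suc i) = e i
  tr-cong e (cast V T) = cong₂ tcast (tr-cong e V) (tr-cong e T)

  tr-ren : ∀ σ f T → tr σ (ren f T) ≡ tr (λ i → σ (f i)) T
  tr-ren σ f (sort s) = refl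
  tr-ren σ f (lref i) = refl
  tr-ren σ f (app V T) = cong₂ tapp (tr-ren σ f V) (tr-ren σ f T)
  tr-ren σ f (bind abst W T) = cong₂ tlam (tr-ren σ f W) (trans (tr-ren (exts σ) (ext f) T) (tr-cong e T))
    where e : (λ i → exts σ (ext f i)) ≗ exts (λ i → σ (f i))
          e zero = refl
          e (suc i) = refl
  tr-ren σ f (bind abbr V T) = cong₂ tkeep (trans (tr-ren _ (ext f) T) (tr-cong e T)) (tr-ren σ f V)
    where e : (λ i → (tr σ (ren f V) ∷ᶠ σ) (ext f i)) ≗ (tr (λ i → σ (f i)) V ∷ᶠ (λ i → σ (f i)))
          e zero = tr-ren σ f V
          e (suc i) = refl
  tr-ren σ f (cast V T) = cong₂ tcast (tr-ren σ f V) (tr-ren σ f T)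

  tr-tren : ∀ g σ T → tr (λ i → tren g (σ i)) T ≡ tren g (tr σ T)
  tr-tren g σ (sort s) = refl
  tr-tren g σ (lref i) = refl
  tr-tren g σ (app V T) = cong₂ tapp (tr-tren g σ V) (tr-tren g σ T)
  tr-tren g σ (bind abst W T) = cong₂ tlam (tr-tren g σ W) (trans (tr-cong e T) (tr-tren (ext g) (exts σ) T))
    where e : exts (λ i → tren g (σ i)) ≗ (λ i → tren (ext g) (exts σ i))
          e zero = refl
          e (suc i) = trans (tren-tren suc g (σ i)) (sym (tren-tren (ext g) suc (σ i)))
  tr-tren g σ (bind abbr V T) = cong₂ tkeep (trans (tr-cong e T) (tr-tren g (tr σ V ∷ᶠ σ) T)) (tr-tren g σ V)
    where e : (tr (λ i → tren g (σ i)) V ∷ᶠ (λ i → tren g (σ i))) ≗ (λ i → tren g ((tr σ V ∷ᶠ σ) i))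
          e zero = tr-tren g σ V
          e (suc i) = refl
  tr-tren g σ (cast V T) = cong₂ tcast (tr-tren g σ V) (tr-tren g σ T)

  tr-tsub : ∀ τ σ T → tr (λ i → tsub τ (σ i)) T ≡ tsub τ (tr σ T)
  tr-tsub τ σ (sort s) = refl
  tr-tsub τ σ (lref i) = refl
  tr-tsub τ σ (app V T) = cong₂ tapp (tr-tsub τ σ V) (tr-tsub τ σ T)
  tr-tsub τ σ (bind abst W T) = cong₂ tlam (tr-tsub τ σ W) (trans (tr-cong e T) (tr-tsub (exts τ) (exts σ) T))
    where e : exts (λ i → tsub τ (σ i)) ≗ (λ i → tsub (exts τ) (exts σ i))
          e zero = refl
          e (suc i) = trans (tren-tsub suc τ (σ i)) (sym (tsub-tren (exts τ) suc (σ i)))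
  tr-tsub τ σ (bind abbr V T) = cong₂ tkeep (trans (tr-cong e T) (tr-tsub τ (tr σ V ∷ᶠ σ) T)) (tr-tsub τ σ V)
    where e : (tr (λ i → tsub τ (σ i)) V ∷ᶠ (λ i → tsub τ (σ i))) ≗ (λ i → tsub τ ((tr σ V ∷ᶠ σ) i))
          e zero = tr-tsub τ σ V
          e (suc i) = refl
  tr-tsub τ σ (cast V T) = cong₂ tcast (tr-tsub τ σ V) (tr-tsub τ σ T)

  tr-lift0 : ∀ σ T → tr σ (lift 0 T) ≡ tr (λ i → σ (suc i)) T
  tr-lift0 σ T = trans (cong (tr σ) (lift0 T)) (tr-ren σ suc T)

  tr-weaken : ∀ σ T → tr (exts σ) (lift 0 T) ≡ tlift (tr σ T)
  tr-weaken σ T = trans (tr-lift0 (exts σ) T) (tr-tren suc σ T)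

  tr-beta : ∀ c σ T → sub1 c (tr (exts σ) T) ≡ tr (c ∷ᶠ σ) T
  tr-beta c σ T = trans (sym (tr-tsub (c ∷ᶠ tvar) (exts σ) T)) (tr-cong e T)
    where e : (λ i → tsub (c ∷ᶠ tvar) (exts σ i)) ≗ (c ∷ᶠ σ)
          e zero = refl
          e (suc i) = sub1-lift c (σ i)

  tr-pointwise : ∀ {γ σ σ'} → (∀ i → Star (Red γ) (σ i) (σ' i)) → ∀ T → Star (Red γ) (tr σ T) (tr σ' T)
  tr-pointwise h (sort s) = ε
  tr-pointwise h (lref i) = h i
  tr-pointwise h (app V T) = gmap _ t-appL (tr-pointwise h V) ◅◅ gmap _ t-appR (tr-pointwise h T)
  tr-pointwise {γ} {σ} {σ'} h (bind abst W T) =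
    gmap _ t-lamW (tr-pointwise h W) ◅◅ gmap _ t-lamT (tr-pointwise h' T)
    where h' : ∀ i → Star (Red (extExp (tr σ' W) γ)) (exts σ i) (exts σ' i)
          h' zero = ε
          h' (suc i) = lift-star (tr σ' W) (h i)
  tr-pointwise {γ} {σ} {σ'} h (bind abbr V T) =
    gmap _ t-keepV (tr-pointwise h V) ◅◅ gmap _ t-keepT (tr-pointwise h' T)
    where h' : ∀ i → Star (Red γ) ((tr σ V ∷ᶠ σ) i) ((tr σ' V ∷ᶠ σ') i)
          h' zero = tr-pointwise h V
          h' (suc i) = h i
  tr-pointwise h (cast V T) = gmap _ t-castU (tr-pointwise h V) ◅◅ gmap _ t-castT (tr-pointwise h T)

  tr-typed : ∀ {Γ T σ Δ σs} → Skel Γ T σ → (∀ i {ρ} → Γ i ≡ just ρ → Typ Δ (σs i) ρ) → Typ Δ (tr σs T) σ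
  tr-typed sk-sort h = ty-sort
  tr-typed (sk-lref {i = i} x) h = h i x
  tr-typed (sk-app d d₁) h = ty-app (tr-typed d h) (tr-typed d₁ h)
  tr-typed {Γ} {Δ = Δ} {σs} (sk-abst {ρ = ρ} d d₁) h = ty-lam (tr-typed d h) (tr-typed d₁ h')
    where h' : ∀ i {ρ'} → (just ρ ∷ᶠ Γ) i ≡ just ρ' → Typ (ρ ∷ᶠ Δ) (exts σs i) ρ'
          h' zero refl = ty-var
          h' (suc i) x = Typ-ren (λ j → refl) (h i x)
  tr-typed {Γ} {Δ = Δ} {σs} (sk-abbr {V = V} {ρ = ρ} d d₁) h = ty-keep (tr-typed d₁ h') (tr-typed d h)
    where h' : ∀ i {ρ'} → (just ρ ∷ᶠ Γ) i ≡ just ρ' → Typ Δ ((tr σs V ∷ᶠ σs) i) ρ'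
          h' zero refl = tr-typed d h
          h' (suc i) x = h i x
  tr-typed (sk-cast d d₁) h = ty-cast (tr-typed d h) (tr-typed d₁ h)

  -- Weights.  An index weighs ω i; a definition entry weighs one more than
  -- its definiens, so unfolding it (which leaves the translation unchanged)
  -- strictly decreases the weight.

  weight : (ℕ → ℕ) → Term → ℕ
  weight ω (sort s) = 1
  weight ω (lref i) = ω i
  weight ω (app V T) = suc (weight ω V + weight ω T)
  weight ω (bind abst V T) = suc (weight ω V + weight (1 ∷ᶠ ω) T)
  weight ω (bind abbr V T) = suc (weight ω V + weight (suc (weight ω V) ∷ᶠ ω) T)
  weight ω (cast V T) = suc (weight ω V + weight ω T)

  weight-cong : ∀ {ω ω'} → ω ≗ ω' → ∀ T → weight ω T ≡ weight ω' T
  weight-cong e (sort s) = refl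
  weight-cong e (lref i) = e i
  weight-cong e (app V T) = cong₂ (λ a c → suc (a + c)) (weight-cong e V) (weight-cong e T)
  weight-cong {ω} {ω'} e (bind abst V T) = cong₂ (λ a c → suc (a + c)) (weight-cong e V) (weight-cong e' T)
    where e' : (1 ∷ᶠ ω) ≗ (1 ∷ᶠ ω')
          e' zero = refl
          e' (suc i) = e i
  weight-cong {ω} {ω'} e (bind abbr V T) = cong₂ (λ a c → suc (a + c)) (weight-cong e V) (weight-cong e' T)
    where e' : (suc (weight ω V) ∷ᶠ ω) ≗ (suc (weight ω' V) ∷ᶠ ω')
          e' zero = cong suc (weight-cong e V)
          e' (suc i) = e i
  weight-cong e (cast V T) = cong₂ (λ a c → suc (a + c)) (weight-cong e V) (weight-cong e T)

  weight-ren : ∀ ω f T → weight ω (ren f T) ≡ weight (λ i → ω (f i)) T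
  weight-ren ω f (sort s) = refl
  weight-ren ω f (lref i) = refl
  weight-ren ω f (app V T) = cong₂ (λ a c → suc (a + c)) (weight-ren ω f V) (weight-ren ω f T)
  weight-ren ω f (bind abst V T) =
    cong₂ (λ a c → suc (a + c)) (weight-ren ω f V) (trans (weight-ren _ (ext f) T) (weight-cong e T))
    where e : (λ i → (1 ∷ᶠ ω) (ext f i)) ≗ (1 ∷ᶠ (λ i → ω (f i)))
          e zero = refl
          e (suc i) = refl
  weight-ren ω f (bind abbr V T) =
    cong₂ (λ a c → suc (a + c)) (weight-ren ω f V) (trans (weight-ren _ (ext f) T) (weight-cong e T))
    where e : (λ i → (suc (weight ω (ren f V)) ∷ᶠ ω) (ext f i)) ≗ (suc (weight (λ i → ω (f i)) V) ∷ᶠ (λ i → ω (f i)))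
          e zero = cong suc (weight-ren ω f V)
          e (suc i) = refl
  weight-ren ω f (cast V T) = cong₂ (λ a c → suc (a + c)) (weight-ren ω f V) (weight-ren ω f T)

  weight-lift0 : ∀ ω T → weight ω (lift 0 T) ≡ weight (λ i → ω (suc i)) T
  weight-lift0 ω T = trans (cong (weight ω) (lift0 T)) (weight-ren ω suc T)

  weight-mono : ∀ {ω ω'} → (∀ i → ω i ≤ ω' i) → ∀ T → weight ω T ≤ weight ω' T
  weight-mono h (sort s) = ≤-refl
  weight-mono h (lref i) = h i
  weight-mono h (app V T) = s≤s (+-mono-≤ (weight-mono h V) (weight-mono h T))
  weight-mono {ω} {ω'} h (bind abst V T) = s≤s (+-mono-≤ (weight-mono h V) (weight-mono h' T))
    where h' : ∀ i → (1 ∷ᶠ ω) i ≤ (1 ∷ᶠ ω') i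
          h' zero = ≤-refl
          h' (suc i) = h i
  weight-mono {ω} {ω'} h (bind abbr V T) = s≤s (+-mono-≤ (weight-mono h V) (weight-mono h' T))
    where h' : ∀ i → (suc (weight ω V) ∷ᶠ ω) i ≤ (suc (weight ω' V) ∷ᶠ ω') i
          h' zero = s≤s (weight-mono h V)
          h' (suc i) = h i
  weight-mono h (cast V T) = s≤s (+-mono-≤ (weight-mono h V) (weight-mono h T))

  data Model : Env → (ℕ → TT) → (ℕ → TT) → (ℕ → ℕ) → Set where
    model-∅    : ∀ {σ γ ω} → Model ∅ σ γ ω
    model-abst : ∀ {K σ γ ω W} → Model K σ γ ω → Model (snoc K abst W) (exts σ) (extExp (tr σ W) γ) (1 ∷ᶠ ω)
    model-abbr : ∀ {K σ γ ω V} → Model K σ γ ω → Model (snoc K abbr V) (tr σ V ∷ᶠ σ) γ (suc (weight ω V) ∷ᶠ ω)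

  Descends : (ℕ → TT) → TT × ℕ → TT × ℕ → Set
  Descends γ (t , n) (t' , n') = Plus (Red γ) t t' ⊎ (t ≡ t' × n' < n)

  descends-cong : ∀ {γ δ t n t' n'} (F : TT → TT) (G : ℕ → ℕ) →
    (∀ {x y} → Red γ x y → Red δ (F x) (F y)) → (∀ {m m'} → m' < m → G m' < G m) →
    Descends γ (t , n) (t' , n') → Descends δ (F t , G n) (F t' , G n')
  descends-cong F G F-red G-mono (inj₁ p) = inj₁ (plus-map F F-red p)
  descends-cong F G F-red G-mono (inj₂ (e , lt)) = inj₂ (cong F e , G-mono lt)

  descends-≡ : ∀ {γ t n t' n' t'' n''} → t' ≡ t'' → n' ≡ n'' →
               Descends γ (t , n) (t' , n') → Descends γ (t , n) (t'' , n'')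
  descends-≡ refl refl d = d

  Simulated : (ℕ → TT) → (ℕ → TT) → (ℕ → ℕ) → Term → Term → Set
  Simulated σ γ ω T T' = Descends γ (tr σ T , weight ω T) (tr σ T' , weight ω T')

  descends-left : ∀ {γ t n t' n'} (F : TT → TT) c → (∀ {x y} → Red γ x y → Red γ (F x) (F y)) →
                  Descends γ (t , n) (t' , n') → Descends γ (F t , suc (n + c)) (F t' , suc (n' + c))
  descends-left F c F-red = descends-cong F (λ n → suc (n + c)) F-red (λ lt → s≤s (+-monoˡ-< c lt))

  descends-right : ∀ {γ δ t n t' n'} (F : TT → TT) a → (∀ {x y} → Red γ x y → Red δ (F x) (F y)) →
                   Descends γ (t , n) (t' , n') → Descends δ (F t , suc (a + n)) (F t' , suc (a + n'))
  descends-right F a F-red = descends-cong F (λ n → suc (a + n)) F-red (λ lt → s≤s (+-monoʳ-< a lt))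

  ≉-lref : ∀ {i T} → ¬ lref (suc i) ≈ lift 0 T → ¬ lref i ≈ T
  ≉-lref nq ≈-lref = nq ≈-lref

  -- changing the definiens of a definition: the new definiens is either
  -- reached by target steps (and so is every occurrence of its variable),
  -- or has the same translation and a smaller weight
  simulate-definiens : ∀ {σ γ ω V₁ V₂} T → Simulated σ γ ω V₁ V₂ →
                       Simulated σ γ ω (bind abbr V₁ T) (bind abbr V₂ T)
  simulate-definiens {σ} {γ} {ω} {V₁} {V₂} T (inj₁ p) =
    inj₁ (plus-map _ t-keepV p ⁺◅◅ gmap _ t-keepT (tr-pointwise instances T))
    where instances : ∀ i → Star (Red γ) ((tr σ V₁ ∷ᶠ σ) i) ((tr σ V₂ ∷ᶠ σ) i)
          instances zero = plus⇒star p
          instances (suc i) = ε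
  simulate-definiens {σ} {γ} {ω} {V₁} {V₂} T (inj₂ (e , lt)) =
    inj₂ (cong₂ tkeep (tr-cong same T) e , s≤s (+-mono-<-≤ lt (weight-mono lighter T)))
    where same : (tr σ V₁ ∷ᶠ σ) ≗ (tr σ V₂ ∷ᶠ σ)
          same zero = e
          same (suc i) = refl
          lighter : ∀ i → (suc (weight ω V₂) ∷ᶠ ω) i ≤ (suc (weight ω V₁) ∷ᶠ ω) i
          lighter zero = <⇒≤ (s≤s lt)
          lighter (suc i) = ≤-refl

  -- Unfolding a variable: an abstraction variable steps to its type in the
  -- target; a definition variable has the same translation as its definiens
  -- and a larger weight.
  simulate-lref : ∀ {L σ γ ω i T} → Model L σ γ ω → L ⊢ lref i ⤳ T → ¬ lref i ≈ T →
                  Simulated σ γ ω (lref i) T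
  simulate-lref (model-abst {σ = σ} {W = W} c) x-lref0 nq =
    inj₁ [ subst (Red _ (tvar 0)) (sym (tr-weaken σ W)) t-var ]⁺
  simulate-lref (model-abbr {σ = σ} {ω = ω} {V = V} c) x-lref0 nq =
    inj₂ (sym (tr-lift0 (tr σ V ∷ᶠ σ) V) , subst (λ z → z < suc (weight ω V)) (sym (weight-lift0 _ V)) ≤-refl)
  simulate-lref (model-abst {σ = σ} c) (x-lref {T = T} r) nq =
    descends-≡ (sym (tr-weaken σ T)) (sym (weight-lift0 _ T))
      (descends-cong tlift (λ n → n) (tren-red (λ i → refl)) (λ lt → lt) (simulate-lref c r (≉-lref nq)))
  simulate-lref (model-abbr {σ = σ} {V = V} c) (x-lref {T = T} r) nq =
    descends-≡ (sym (tr-lift0 (tr σ V ∷ᶠ σ) T)) (sym (weight-lift0 _ T)) (simulate-lref c r (≉-lref nq))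

  simulation : ∀ {L σ γ ω T T'} → Model L σ γ ω → L ⊢ T ⤳ T' → ¬ T ≈ T' → Simulated σ γ ω T T'
  simulation {σ = σ} {γ} c (x-beta {V = V} {W} {T}) nq =
    inj₁ [ subst (Red γ _) (cong (λ z → tkeep z (tcast (tr σ W) (tr σ V))) (tr-beta _ σ T)) t-beta ]⁺
  simulation {σ = σ} {γ} c (x-theta {V = V} {W} {T}) nq =
    inj₁ [ subst (Red γ _) (cong (λ z → tkeep (tapp z _) (tr σ W)) (sym (tr-lift0 (tr σ W ∷ᶠ σ) V))) t-theta ]⁺
  simulation c r@x-lref0 nq = simulate-lref c r nq
  simulation {σ = σ} {γ} c (x-zeta {V = V} {T}) nq =
    inj₁ [ subst (Red γ _) (tr-lift0 (tr σ V ∷ᶠ σ) T) t-zeta ]⁺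
  simulation c x-eps nq = inj₁ [ t-eps ]⁺
  simulation c x-sort nq = ⊥-elim (nq ≈-sort)
  simulation c x-ee nq = inj₁ [ t-ee ]⁺
  simulation c r@(x-lref _) nq = simulate-lref c r nq
  simulation {T = app _ T} c (x-appV r) nq =
    descends-left (λ z → tapp z _) _ t-appL (simulation c r (λ p → nq (≈-app p (≈-refl T))))
  simulation {T = app V _} c (x-appT r) nq =
    descends-right (tapp _) _ t-appR (simulation c r (λ p → nq (≈-app (≈-refl V) p)))
  simulation {T = cast _ T} c (x-castU r) nq =
    descends-left (λ z → tcast z _) _ t-castU (simulation c r (λ p → nq (≈-cast p (≈-refl T))))
  simulation {T = cast V _} c (x-castT r) nq =
    descends-right (tcast _) _ t-castT (simulation c r (λ p → nq (≈-cast (≈-refl V) p)))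
  simulation {T = bind abst _ T} c (x-bindV r) nq =
    descends-left (λ z → tlam z _) _ t-lamW (simulation c r (λ p → nq (≈-bind p (≈-refl T))))
  simulation {T = bind abbr V₁ T} {bind abbr V₂ _} c (x-bindV r) nq =
    simulate-definiens {V₁ = V₁} {V₂} T (simulation c r (λ p → nq (≈-bind p (≈-refl T))))
  simulation {T = bind abst V _} c (x-bindT r) nq =
    descends-right (tlam _) _ t-lamT (simulation (model-abst c) r (λ p → nq (≈-bind (≈-refl V) p)))
  simulation {T = bind abbr V _} c (x-bindT r) nq =
    descends-right (λ z → tkeep z _) _ t-keepT (simulation (model-abbr c) r (λ p → nq (≈-bind (≈-refl V) p)))

  _⤳≉_ : Term → Term → Set
  C ⤳≉ C' = (∅ ⊢ C ⤳ C') × ¬ C ≈ C'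

  -- weights of closed terms (the environment part is irrelevant)
  ω₁ : ℕ → ℕ
  ω₁ _ = 1

  -- Induction on the target normalization of a term t reaching the image of
  -- C; for steps that leave the image unchanged, on the weight of C.
  sn-by-translation : ∀ {t} → SNᵗ t → ∀ C → Star (Red γ₀) t (tr tvar C) → SNᴿ _⤳≉_ C
  sn-by-translation {t} (acc h) C t⟶C = by-weight (<-wellFounded _) t⟶C
    where
    by-weight : ∀ {C} → Acc _<_ (weight ω₁ C) → Star (Red γ₀) t (tr tvar C) → SNᴿ _⤳≉_ C
    descend : ∀ {C C'} → (∀ {m} → m < weight ω₁ C → Acc _<_ m) → Star (Red γ₀) t (tr tvar C) →
              Simulated tvar γ₀ ω₁ C C' → SNᴿ _⤳≉_ C'
    by-weight {C} (acc w) t⟶C =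
      acc λ { (r , nq) → descend {C} w t⟶C (simulation {σ = tvar} {γ₀} {ω₁} model-∅ r nq) }
    descend w t⟶C (inj₁ p) with t⟶C ◅◅⁺ p
    ... | q ◅⁺ s = sn-by-translation (h q) _ s
    descend w t⟶C (inj₂ (e , lt)) = by-weight (w lt) (subst (Star (Red γ₀) t) e t⟶C)

  closed-sn : ∀ {C σ} → Skel (λ _ → nothing) C σ → SNᴿ _⤳≉_ C
  closed-sn d = sn-by-translation (typed⇒sn (tr-typed d (λ i ()))) _ ε

  lref-⇒⊆⤳ : ∀ {L i n T} → L ⊢ lref i ⇒[ n ] T → L ⊢ lref i ⤳ T
  lref-⇒⊆⤳ r-delta = x-lref0
  lref-⇒⊆⤳ r-ell = x-lref0
  lref-⇒⊆⤳ (r-lref r) = x-lref (lref-⇒⊆⤳ r)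

  ⇒⊆⤳* : ∀ {L T n T'} → L ⊢ T ⇒[ n ] T' → Star (L ⊢_⤳_) T T'
  ⇒⊆⤳* r-beta = x-beta ◅ ε
  ⇒⊆⤳* r-delta = x-lref0 ◅ ε
  ⇒⊆⤳* r-zeta = x-zeta ◅ ε
  ⇒⊆⤳* r-theta = x-theta ◅ ε
  ⇒⊆⤳* r-eps = x-eps ◅ ε
  ⇒⊆⤳* r-sort = x-sort ◅ ε
  ⇒⊆⤳* r-ell = x-lref0 ◅ ε
  ⇒⊆⤳* r-ee = x-ee ◅ ε
  ⇒⊆⤳* (r-lref r) = x-lref (lref-⇒⊆⤳ r) ◅ ε
  ⇒⊆⤳* (r-appV r) = gmap _ x-appV (⇒⊆⤳* r)
  ⇒⊆⤳* (r-appT r) = gmap _ x-appT (⇒⊆⤳* r)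
  ⇒⊆⤳* (r-bindV r) = gmap _ x-bindV (⇒⊆⤳* r)
  ⇒⊆⤳* (r-bindT r) = gmap _ x-bindT (⇒⊆⤳* r)
  ⇒⊆⤳* (r-castU r) = gmap _ x-castU (⇒⊆⤳* r)
  ⇒⊆⤳* (r-castT r) = gmap _ x-castT (⇒⊆⤳* r)
  ⇒⊆⤳* (r-cast1 r r₁) = gmap _ x-castU (⇒⊆⤳* r) ◅◅ gmap _ x-castT (⇒⊆⤳* r₁)

  ⇒*⊆⤳* : ∀ {L T n T'} → L ⊢ T ⇒*[ n ] T' → Star (L ⊢_⤳_) T T'
  ⇒*⊆⤳* rs-refl = ε
  ⇒*⊆⤳* (rs-step r) = ⇒⊆⤳* r
  ⇒*⊆⤳* (rs-trans r r₁) = ⇒*⊆⤳* r ◅◅ ⇒*⊆⤳* r₁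

  envSkel-nothing : ∀ L → EnvSkel L (λ _ → nothing)
  envSkel-nothing ∅ = es-∅ (λ i → refl)
  envSkel-nothing (snoc L b V) = es-snoc (envSkel-nothing L) tt

  mergeᵐ : Maybe Ty → Maybe Ty → Maybe Ty
  mergeᵐ (just x) m = just x
  mergeᵐ nothing m = m

  _⊔ᶜ_ : Ctx → Ctx → Ctx
  (Γ₁ ⊔ᶜ Γ₂) i = mergeᵐ (Γ₁ i) (Γ₂ i)

  ≤⊔ᶜˡ : ∀ {Γ₁ Γ₂} → Γ₁ ≤ᶜ (Γ₁ ⊔ᶜ Γ₂)
  ≤⊔ᶜˡ {Γ₁} i e rewrite e = refl

  ≤⊔ᶜʳ : ∀ {Γ₁ Γ₂} → Compatible Γ₁ Γ₂ → Γ₂ ≤ᶜ (Γ₁ ⊔ᶜ Γ₂)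
  ≤⊔ᶜʳ {Γ₁} {Γ₂} c i {x} e with Γ₁ i in eq
  ... | just y = cong just (c i eq e)
  ... | nothing = e

  envSkel-compatible : ∀ {L Γ₁ Γ₂} → EnvSkel L Γ₁ → EnvSkel L Γ₂ → Compatible Γ₁ Γ₂
  envSkel-compatible (es-∅ n₁) o₂ i e₁ e₂ with trans (sym (n₁ i)) e₁
  ... | ()
  envSkel-compatible o₁@(es-snoc t₁ _) o₂@(es-snoc t₂ _) zero e₁ e₂ =
    Skel-unique (entry-skel o₁ e₁) (entry-skel o₂ e₂) (envSkel-compatible t₁ t₂)
  envSkel-compatible (es-snoc t₁ _) (es-snoc t₂ _) (suc i) e₁ e₂ = envSkel-compatible t₁ t₂ i e₁ e₂

  entrySkel-merge : ∀ {G₁ G₂ G V} m₁ m₂ → EntrySkel G₁ V m₁ → EntrySkel G₂ V m₂ → G₁ ≤ᶜ G → G₂ ≤ᶜ G →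
                    EntrySkel G V (mergeᵐ m₁ m₂)
  entrySkel-merge (just x) m₂ e₁ e₂ l₁ l₂ = Skel-mono e₁ l₁
  entrySkel-merge nothing (just x) e₁ e₂ l₁ l₂ = Skel-mono e₂ l₂
  entrySkel-merge nothing nothing e₁ e₂ l₁ l₂ = tt

  envSkel-merge : ∀ {L Γ₁ Γ₂} → EnvSkel L Γ₁ → EnvSkel L Γ₂ → EnvSkel L (Γ₁ ⊔ᶜ Γ₂)
  envSkel-merge (es-∅ n₁) (es-∅ n₂) = es-∅ λ i → trans (cong (λ m → mergeᵐ m _) (n₁ i)) (n₂ i)
  envSkel-merge {Γ₁ = Γ₁} {Γ₂} (es-snoc t₁ e₁) (es-snoc t₂ e₂) =
    es-snoc (envSkel-merge t₁ t₂)
            (entrySkel-merge (Γ₁ 0) (Γ₂ 0) e₁ e₂ ≤⊔ᶜˡ (≤⊔ᶜʳ (envSkel-compatible t₁ t₂)))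

  skel-merge : ∀ {L Γ₁ Γ₂ T₁ T₂ σ₁ σ₂} → EnvSkel L Γ₁ → Skel Γ₁ T₁ σ₁ → EnvSkel L Γ₂ → Skel Γ₂ T₂ σ₂ →
               EnvSkel L (Γ₁ ⊔ᶜ Γ₂) × Skel (Γ₁ ⊔ᶜ Γ₂) T₁ σ₁ × Skel (Γ₁ ⊔ᶜ Γ₂) T₂ σ₂
  skel-merge ok₁ d₁ ok₂ d₂ =
    envSkel-merge ok₁ ok₂ , Skel-mono d₁ ≤⊔ᶜˡ , Skel-mono d₂ (≤⊔ᶜʳ (envSkel-compatible ok₁ ok₂))

  Typable : Env → Term → Set
  Typable L T = Σ Ctx λ Γ → Σ Ty λ σ → EnvSkel L Γ × Skel Γ T σ

  -- the type of the binder's variable is forced by its declaration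
  typable-bind : ∀ {L Γ₁ Γ₂ b V T ρ τ} → EnvSkel L Γ₁ → Skel Γ₁ V ρ →
                 EnvSkel (snoc L b V) Γ₂ → Skel Γ₂ T τ → Typable L (bind b V T)
  typable-bind {Γ₁ = Γ₁} {Γ₂} {b} {V} {T} {ρ} {τ} ok₁ sV ok₂@(es-snoc ok₂' _) sT =
    G , result b , envSkel-merge ok₁ ok₂' , skel b
    where
    G = Γ₁ ⊔ᶜ (λ i → Γ₂ (suc i))
    c = envSkel-compatible ok₁ ok₂'
    scope : Γ₂ ≤ᶜ (just ρ ∷ᶠ G)
    scope zero e = cong just (Skel-unique sV (entry-skel ok₂ e) c)
    scope (suc i) e = ≤⊔ᶜʳ c i e
    result : Bind → Ty
    result abst = ρ ⇒ τ
    result abbr = τ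
    skel : ∀ b → Skel G (bind b V T) (result b)
    skel abst = sk-abst (Skel-mono sV ≤⊔ᶜˡ) (Skel-mono sT scope)
    skel abbr = sk-abbr (Skel-mono sV ≤⊔ᶜˡ) (Skel-mono sT scope)

  -- Cast and application conditions force matching skeletons, because
  -- rt-reduction preserves them.
  valid⇒typable : ∀ {A L T} → Valid A L T → Typable L T
  valid⇒typable {L = L} v-sort = _ , ι , envSkel-nothing L , sk-sort
  valid⇒typable (v-zero v) with valid⇒typable v
  ... | Γ , σ , ok , d = (just σ ∷ᶠ Γ) , σ , es-snoc ok d , sk-lref refl
  valid⇒typable (v-suc v) with valid⇒typable v
  ... | Γ , σ , ok , sk-lref e = (nothing ∷ᶠ Γ) , σ , es-snoc ok tt , sk-lref e
  valid⇒typable (v-bind vV vT) with valid⇒typable vV | valid⇒typable vT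
  ... | _ , _ , ok₁ , sV | _ , _ , ok₂ , sT = typable-bind ok₁ sV ok₂ sT
  valid⇒typable (v-cast vU vT U₀ rT rU) with valid⇒typable vU | valid⇒typable vT
  ... | _ , _ , ok₁ , sU | _ , _ , ok₂ , sT with skel-merge ok₁ sU ok₂ sT
  ... | ok , sU' , sT'
        with Skel-unique (subject-red* ok sU' (⇒*⊆⤳* rU)) (subject-red* ok sT' (⇒*⊆⤳* rT)) (compatible-refl _)
  ... | refl = _ , _ , ok , sk-cast sU' sT'
  valid⇒typable (v-app vV vT n a W₀ U₀ rT rV) with valid⇒typable vV | valid⇒typable vT
  ... | _ , _ , ok₁ , sV | _ , _ , ok₂ , sT with skel-merge ok₁ sV ok₂ sT
  ... | ok , sV' , sT' with subject-red* ok sT' (⇒*⊆⤳* rT)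
  ... | sk-abst sW _ with Skel-unique (subject-red* ok sV' (⇒*⊆⤳* rV)) sW (compatible-refl _)
  ... | refl = _ , _ , ok , sk-app sV' sT'

  -- Masked environments.  L̂ agrees with L on the entries that Γ types;
  -- reduction of a Γ-typed term only consults such entries.

  AgreeEntry : Maybe Ty → Term → Term → Set
  AgreeEntry nothing V V' = ⊤
  AgreeEntry (just _) V V' = V ≡ V'

  data Agree : Ctx → Env → Env → Set where
    ag-∅    : ∀ {Γ} → Agree Γ ∅ ∅
    ag-snoc : ∀ {Γ K K' b V V'} → Agree (λ i → Γ (suc i)) K K' → AgreeEntry (Γ 0) V V' →
              Agree Γ (snoc K b V) (snoc K' b V')

  transfer : ∀ {L L' Γ T T' σ} → Agree Γ L L' → Skel Γ T σ → L ⊢ T ⤳ T' → L' ⊢ T ⤳ T'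
  transfer ag (sk-app _ _) x-beta = x-beta
  transfer ag (sk-app _ _) x-theta = x-theta
  transfer (ag-snoc ag ae) (sk-lref e) x-lref0 with subst (λ m → AgreeEntry m _ _) e ae
  ... | refl = x-lref0
  transfer ag _ x-zeta = x-zeta
  transfer ag _ x-eps = x-eps
  transfer ag _ x-sort = x-sort
  transfer ag _ x-ee = x-ee
  transfer (ag-snoc ag ae) (sk-lref e) (x-lref r) = x-lref (transfer ag (sk-lref e) r)
  transfer ag (sk-app d d₁) (x-appV r) = x-appV (transfer ag d r)
  transfer ag (sk-abst d d₁) (x-bindV r) = x-bindV (transfer ag d r)
  transfer ag (sk-abbr d d₁) (x-bindV r) = x-bindV (transfer ag d r)
  transfer ag (sk-cast d d₁) (x-castU r) = x-castU (transfer ag d r)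
  transfer ag (sk-app d d₁) (x-appT r) = x-appT (transfer ag d₁ r)
  transfer ag (sk-cast d d₁) (x-castT r) = x-castT (transfer ag d₁ r)
  transfer ag (sk-abst d d₁) (x-bindT r) = x-bindT (transfer (ag-snoc ag refl) d₁ r)
  transfer ag (sk-abbr d d₁) (x-bindT r) = x-bindT (transfer (ag-snoc ag refl) d₁ r)

  free⇒typed : ∀ {L Γ T σ i} → EnvSkel L Γ → Skel Γ T σ → Free L T i → ∃ λ x → Γ i ≡ just x
  free⇒typed ok (sk-lref e) f-here = _ , e
  free⇒typed ok@(es-snoc ok' _) (sk-lref e) (f-entry f) = free⇒typed ok' (entry-skel ok e) f
  free⇒typed ok (sk-lref e) f-empty = _ , e
  free⇒typed (es-snoc ok _) (sk-lref e) (f-lref f) = free⇒typed ok (sk-lref e) f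
  free⇒typed ok (sk-abst d d₁) (f-bindV f) = free⇒typed ok d f
  free⇒typed ok (sk-abbr d d₁) (f-bindV f) = free⇒typed ok d f
  free⇒typed ok (sk-abst d d₁) (f-bindT f) = free⇒typed (es-snoc ok d) d₁ f
  free⇒typed ok (sk-abbr d d₁) (f-bindT f) = free⇒typed (es-snoc ok d) d₁ f
  free⇒typed ok (sk-app d d₁) (f-appV f) = free⇒typed ok d f
  free⇒typed ok (sk-app d d₁) (f-appT f) = free⇒typed ok d₁ f
  free⇒typed ok (sk-cast d d₁) (f-castU f) = free⇒typed ok d f
  free⇒typed ok (sk-cast d d₁) (f-castT f) = free⇒typed ok d₁ f

  AllTyped : Env → Ctx → Set
  AllTyped ∅ Γ = ⊤
  AllTyped (snoc K b V) Γ = (∃ λ ρ → Γ 0 ≡ just ρ) × AllTyped K (λ i → Γ (suc i))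

  Masked : Env → Ctx → Set
  Masked L Γ = Σ Env λ L̂ → Σ Ctx λ Γ̂ → EnvSkel L̂ Γ̂ × AllTyped L̂ Γ̂ × Γ ≤ᶜ Γ̂ × Agree Γ L L̂

  mask : S → ∀ {L Γ} → EnvSkel L Γ → Masked L Γ
  mask s₀ {∅} {Γ} (es-∅ n) = ∅ , Γ , es-∅ n , tt , (λ i e → e) , ag-∅
  mask s₀ {snoc K b V} {Γ} (es-snoc ok en) with mask s₀ ok
  ... | K̂ , ΓK , okK , allK , leK , agK = by-entry (Γ 0) refl en
    where
    by-entry : ∀ m → Γ 0 ≡ m → EntrySkel (λ i → Γ (suc i)) V m → Masked (snoc K b V) Γ
    by-entry (just ρ) e en' =
      snoc K̂ b V , (just ρ ∷ᶠ ΓK) , es-snoc okK (Skel-mono en' leK) , ((ρ , refl) , allK) , le ,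
      ag-snoc agK (subst (λ m → AgreeEntry m V V) (sym e) refl)
      where le : Γ ≤ᶜ (just ρ ∷ᶠ ΓK)
            le zero x = trans (sym e) x
            le (suc i) x = leK i x
    by-entry nothing e en' =
      snoc K̂ b (sort s₀) , (just ι ∷ᶠ ΓK) , es-snoc okK sk-sort , ((ι , refl) , allK) , le ,
      ag-snoc agK (subst (λ m → AgreeEntry m V (sort s₀)) (sym e) tt)
      where le : Γ ≤ᶜ (just ι ∷ᶠ ΓK)
            le zero x with trans (sym e) x
            ... | ()
            le (suc i) x = leK i x

  close : Env → Term → Term
  close ∅ T = T
  close (snoc K b V) T = close K (bind b V T)

  close-typed : ∀ {L Γ T σ} → EnvSkel L Γ → AllTyped L Γ → Skel Γ T σ →
                Σ Ty λ σ' → Skel (λ _ → nothing) (close L T) σ'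
  close-typed (es-∅ n) all d = _ , Skel-mono d (λ i x → trans (sym (n i)) x)
  close-typed {snoc K b V} {Γ} {T} {σ} ok@(es-snoc ok' en) ((ρ , e) , all) d = close-typed ok' all (bound b)
    where
    scope : Skel (just ρ ∷ᶠ (λ i → Γ (suc i))) T σ
    scope = Skel-mono d λ { zero x → trans (sym e) x ; (suc i) x → x }
    result : Bind → Ty
    result abst = ρ ⇒ σ
    result abbr = σ
    bound : ∀ b → Skel (λ i → Γ (suc i)) (bind b V T) (result b)
    bound abst = sk-abst (entry-skel ok e) scope
    bound abbr = sk-abbr (entry-skel ok e) scope

  Closure : Set
  Closure = Env × Term

  _⊐_ : Closure → Closure → Set
  (L , T) ⊐ (L' , T') = Sub L T L' T'

  reach-close : ∀ L T → Star _⊐_ (∅ , close L T) (L , T)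
  reach-close ∅ T = ε
  reach-close (snoc K b V) T = reach-close K (bind b V T) ◅◅ (sub-bindT ◅ ε)

  data EnvStep : Env → Env → Set where
    step-tail : ∀ {K K' b V} → EnvStep K K' → EnvStep (snoc K b V) (snoc K' b V)
    step-head : ∀ {K b V V'} → K ⊢ V ⤳ V' → ¬ V ≈ V' → EnvStep (snoc K b V) (snoc K b V')

  data ClosureStep : Closure → Closure → Set where
    step-term : ∀ {L T T'} → L ⊢ T ⤳ T' → ¬ T ≈ T' → ClosureStep (L , T) (L , T')
    step-env  : ∀ {L L' T} → EnvStep L L' → ClosureStep (L , T) (L' , T)

  lift-⊐ : ∀ {x y y'} → x ⊐ y → ClosureStep y y' → Σ Closure λ x' → ClosureStep x x' × x' ⊐ y'
  lift-⊐ sub-lref0 (step-term r nq) = _ , step-env (step-head r nq) , sub-lref0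
  lift-⊐ sub-lref0 (step-env e) = _ , step-env (step-tail e) , sub-lref0
  lift-⊐ (sub-drop {T = T}) (step-term {T' = T'} r nq) =
    _ , step-term (lift-⤳ r) (λ p → nq (≈-unlift T T' p)) , sub-drop
  lift-⊐ sub-drop (step-env e) = _ , step-env (step-tail e) , sub-drop
  lift-⊐ sub-appV (step-term r nq) = _ , step-term (x-appV r) (λ { (≈-app p _) → nq p }) , sub-appV
  lift-⊐ sub-appV (step-env e) = _ , step-env e , sub-appV
  lift-⊐ sub-appT (step-term r nq) = _ , step-term (x-appT r) (λ { (≈-app _ p) → nq p }) , sub-appT
  lift-⊐ sub-appT (step-env e) = _ , step-env e , sub-appT
  lift-⊐ sub-castU (step-term r nq) = _ , step-term (x-castU r) (λ { (≈-cast p _) → nq p }) , sub-castU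
  lift-⊐ sub-castU (step-env e) = _ , step-env e , sub-castU
  lift-⊐ sub-castT (step-term r nq) = _ , step-term (x-castT r) (λ { (≈-cast _ p) → nq p }) , sub-castT
  lift-⊐ sub-castT (step-env e) = _ , step-env e , sub-castT
  lift-⊐ sub-bindV (step-term r nq) = _ , step-term (x-bindV r) (λ { (≈-bind p _) → nq p }) , sub-bindV
  lift-⊐ sub-bindV (step-env e) = _ , step-env e , sub-bindV
  lift-⊐ sub-bindT (step-term r nq) = _ , step-term (x-bindT r) (λ { (≈-bind _ p) → nq p }) , sub-bindT
  lift-⊐ sub-bindT (step-env (step-tail e)) = _ , step-env e , sub-bindT
  lift-⊐ sub-bindT (step-env (step-head r nq)) = _ , step-term (x-bindV r) (λ { (≈-bind p _) → nq p }) , sub-bindT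

  lift-⊐* : ∀ {x y y'} → Star _⊐_ x y → ClosureStep y y' → Σ Closure λ x' → ClosureStep x x' × Star _⊐_ x' y'
  lift-⊐* ε st = _ , st , ε
  lift-⊐* (s ◅ rc) st with lift-⊐* rc st
  ... | x' , st' , rc' with lift-⊐ s st'
  ... | x'' , st'' , s' = x'' , st'' , s' ◅ rc'

  lift-to-closed : ∀ {C y y'} → Star _⊐_ (∅ , C) y → ClosureStep y y' →
                   Σ Term λ C' → C ⤳≉ C' × Star _⊐_ (∅ , C') y'
  lift-to-closed rc st with lift-⊐* rc st
  ... | _ , step-term r nq , rc' = _ , (r , nq) , rc'
  ... | _ , step-env () , _

  -- The hypothesis ¬ ClosureApprox of a
  -- qrst-step only says that no derivation of EnvRel exists; to locate a
  -- changed entry we argue under double negation, where excluded middle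
  -- on the (undecided) relevance f 0 is available.

  ¬¬-excluded-middle : ∀ {ℓ} {P : Set ℓ} → ¬ ¬ (P ⊎ ¬ P)
  ¬¬-excluded-middle k = k (inj₂ (λ x → k (inj₁ x)))

  data Pointwise : (ℕ → Set) → Env → Env → Set₁ where
    pw-∅    : ∀ {f} → Pointwise f ∅ ∅
    pw-snoc : ∀ {f K K' b V V'} → Pointwise (λ i → f (suc i)) K K' → (V ≈ V' ⊎ ¬ f 0) →
              Pointwise f (snoc K b V) (snoc K' b V')

  ¬¬envRel : ∀ {f L L'} → Pointwise f L L' → ¬ ¬ EnvRel _≈_ f L L'
  ¬¬envRel pw-∅ k = k er-empty
  ¬¬envRel (pw-snoc p (inj₁ e)) k = ¬¬envRel p λ r → ¬¬-excluded-middle λ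
    { (inj₁ x) → k (er-keep r x e)
    ; (inj₂ nx) → k (er-skip r nx) }
  ¬¬envRel (pw-snoc p (inj₂ nf)) k = ¬¬envRel p λ r → k (er-skip r nf)

  pointwise-refl : ∀ {f} L → Pointwise f L L
  pointwise-refl ∅ = pw-∅
  pointwise-refl (snoc L b V) = pw-snoc (pointwise-refl L) (inj₁ (≈-refl V))

  ≡⇒≈ : ∀ {f L L'} → EnvRel _≡_ f L L' → EnvRel _≈_ f L L'
  ≡⇒≈ er-empty = er-empty
  ≡⇒≈ (er-skip e x) = er-skip (≡⇒≈ e) x
  ≡⇒≈ (er-keep {V₁ = V} e x refl) = er-keep (≡⇒≈ e) x (≈-refl V)

  lift-env-step : ∀ {L L₂ Γ L̂} {f : ℕ → Set} → L ⤳ₑ L₂ → EnvSkel L Γ → Agree Γ L L̂ →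
                  (∀ i → f i → ∃ λ x → Γ i ≡ just x) → ¬ EnvRel _≈_ f L L₂ →
                  Σ Env λ L̂₂ → EnvStep L̂ L̂₂ × EnvSkel L₂ Γ × Agree Γ L₂ L̂₂
  lift-env-step {f = f} (xe-tail {V = V} e) (es-snoc ok en) (ag-snoc ag ae) typed changed
    with lift-env-step e ok ag (λ i x → typed (suc i) x) changed-tail
    where changed-tail : ¬ EnvRel _≈_ (λ i → f (suc i)) _ _
          changed-tail er = ¬¬-excluded-middle λ
            { (inj₁ x) → changed (er-keep er x (≈-refl V))
            ; (inj₂ nx) → changed (er-skip er nx) }
  ... | L̂₂ , st , ok₂ , ag₂ = _ , step-tail st , es-snoc ok₂ en , ag-snoc ag₂ ae
  lift-env-step {L = snoc K b V} {Γ = Γ} {f = f} (xe-head {V₂ = V₂} r) (es-snoc ok en) (ag-snoc ag ae) typed changed =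
    by-entry (Γ 0) refl en ae
    where
    by-entry : ∀ m → Γ 0 ≡ m → EntrySkel (λ i → Γ (suc i)) V m → AgreeEntry m V _ →
               Σ Env λ L̂₂ → EnvStep _ L̂₂ × EnvSkel (snoc K b V₂) Γ × Agree Γ (snoc K b V₂) L̂₂
    by-entry (just ρ) e en' refl =
      _ , step-head (transfer ag en' r) (λ p → ¬¬envRel (pw-snoc (pointwise-refl K) (inj₁ p)) changed) ,
      es-snoc ok (subst (EntrySkel _ V₂) (sym e) (subject-red ok en' r)) ,
      ag-snoc ag (subst (λ m → AgreeEntry m V₂ V₂) (sym e) refl)
    by-entry nothing e en' ae' = ⊥-elim (¬¬envRel (pw-snoc (pointwise-refl K) (inj₂ irrelevant)) changed)
      where irrelevant : ¬ f 0
            irrelevant x with typed 0 x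
            ... | _ , e' with trans (sym e) e'
            ... | ()

  size : Term → ℕ
  size (sort s) = 1
  size (lref i) = 1
  size (app V T) = suc (size V + size T)
  size (bind b V T) = suc (size V + size T)
  size (cast V T) = suc (size V + size T)

  envSize : Env → ℕ
  envSize ∅ = 0
  envSize (snoc K b V) = envSize K + size V

  closureSize : Env → Term → ℕ
  closureSize L T = envSize L + size T

  size-ren : ∀ f T → size (ren f T) ≡ size T
  size-ren f (sort s) = refl
  size-ren f (lref i) = refl
  size-ren f (app V T) = cong₂ (λ a c → suc (a + c)) (size-ren f V) (size-ren f T)
  size-ren f (bind b V T) = cong₂ (λ a c → suc (a + c)) (size-ren f V) (size-ren (ext f) T)
  size-ren f (cast V T) = cong₂ (λ a c → suc (a + c)) (size-ren f V) (size-ren f T)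

  size-pos : ∀ T → 0 < size T
  size-pos (sort s) = s≤s z≤n
  size-pos (lref i) = s≤s z≤n
  size-pos (app V T) = s≤s z≤n
  size-pos (bind b V T) = s≤s z≤n
  size-pos (cast V T) = s≤s z≤n

  <-first : ∀ a v t → a + v < a + suc (v + t)
  <-first a v t = +-monoʳ-< a (s≤s (m≤m+n v t))

  <-second : ∀ a v t → a + t < a + suc (v + t)
  <-second a v t = +-monoʳ-< a (s≤s (m≤n+m t v))

  <-scope : ∀ a v t → (a + v) + t < a + suc (v + t)
  <-scope a v t rewrite +-assoc a v t = +-monoʳ-< a ≤-refl

  SubclosureInvariant : Closure → Closure → Set
  SubclosureInvariant (L , T) (L₂ , T₂) = ∀ {Γ σ L̂} → EnvSkel L Γ → Skel Γ T σ → Agree Γ L L̂ →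
    closureSize L₂ T₂ < closureSize L T ×
    (Σ Ctx λ Γ₂ → Σ Ty λ σ₂ → Σ Env λ L̂₂ →
       EnvSkel L₂ Γ₂ × Skel Γ₂ T₂ σ₂ × Agree Γ₂ L₂ L̂₂ × (L̂ , T) ⊐ (L̂₂ , T₂))

  subclosure-step : ∀ {x y} → x ⊐ y → SubclosureInvariant x y
  subclosure-step (sub-lref0 {K = K} {V = V}) ok@(es-snoc ok' en) (sk-lref e) (ag-snoc ag ae) =
    m<m+n (closureSize K V) (s≤s z≤n) ,
    _ , _ , _ , ok' , entry-skel ok e , ag ,
    subst (λ v → (snoc _ _ v , lref 0) ⊐ (_ , V)) (subst (λ m → AgreeEntry m V _) e ae) sub-lref0
  subclosure-step (sub-drop {K = K} {V = V} {T = T}) (es-snoc ok' en) d (ag-snoc ag ae) =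
    subst (λ z → envSize K + size T < envSize K + size V + z) (sym (trans (cong size (lift0 T)) (size-ren suc T)))
          (+-monoˡ-< (size T) (m<m+n (envSize K) (size-pos V))) ,
    _ , _ , _ , ok' , Skel-unlift d , ag , sub-drop
  subclosure-step (sub-appV {L} {V} {T}) ok (sk-app d d₁) ag =
    <-first (envSize L) (size V) (size T) , _ , _ , _ , ok , d , ag , sub-appV
  subclosure-step (sub-appT {L} {V} {T}) ok (sk-app d d₁) ag =
    <-second (envSize L) (size V) (size T) , _ , _ , _ , ok , d₁ , ag , sub-appT
  subclosure-step (sub-castU {L} {V} {T}) ok (sk-cast d d₁) ag =
    <-first (envSize L) (size V) (size T) , _ , _ , _ , ok , d , ag , sub-castU
  subclosure-step (sub-castT {L} {V} {T}) ok (sk-cast d d₁) ag =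
    <-second (envSize L) (size V) (size T) , _ , _ , _ , ok , d₁ , ag , sub-castT
  subclosure-step (sub-bindV {L} {abst} {V} {T}) ok (sk-abst d d₁) ag =
    <-first (envSize L) (size V) (size T) , _ , _ , _ , ok , d , ag , sub-bindV
  subclosure-step (sub-bindV {L} {abbr} {V} {T}) ok (sk-abbr d d₁) ag =
    <-first (envSize L) (size V) (size T) , _ , _ , _ , ok , d , ag , sub-bindV
  subclosure-step (sub-bindT {L} {abst} {V} {T}) ok (sk-abst d d₁) ag =
    <-scope (envSize L) (size V) (size T) , _ , _ , _ , es-snoc ok d , d₁ , ag-snoc ag refl , sub-bindT
  subclosure-step (sub-bindT {L} {abbr} {V} {T}) ok (sk-abbr d d₁) ag =
    <-scope (envSize L) (size V) (size T) , _ , _ , _ , es-snoc ok d , d₁ , ag-snoc ag refl , sub-bindT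

  -- Strong qrst-normalization of the typed subclosures of a masked, closed
  -- term C: by induction on C's normalization and, for subclosure steps,
  -- on the size of the closure.
  mutual
    sn-subclosure : ∀ {C} → SNᴿ _⤳≉_ C → ∀ {L T Γ σ L̂} → Acc _<_ (closureSize L T) →
                    EnvSkel L Γ → Skel Γ T σ → Agree Γ L L̂ → Star _⊐_ (∅ , C) (L̂ , T) → SN L T
    sn-subclosure sn-C s ok d ag rc = sn (sn-qrst-step sn-C s ok d ag rc)

    sn-qrst-step : ∀ {C} → SNᴿ _⤳≉_ C → ∀ {L T Γ σ L̂} → Acc _<_ (closureSize L T) →
                   EnvSkel L Γ → Skel Γ T σ → Agree Γ L L̂ → Star _⊐_ (∅ , C) (L̂ , T) →
                   ∀ L₂ T₂ → Step L T L₂ T₂ → ¬ ClosureApprox L T L₂ T₂ → SN L₂ T₂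
    sn-qrst-step (acc h) {L} {T} s ok d ag rc L₂ T₂ (st-red r) changed
      with lift-to-closed rc (step-term (transfer ag d r) λ p → ¬¬envRel (pointwise-refl L) λ er → changed (er , p))
    ... | C' , r' , rc' = sn-subclosure (h r') (<-wellFounded _) ok (subject-red ok d r) ag rc'
    sn-qrst-step (acc h) {T = T} s ok d ag rc L₂ T₂ (st-env e) changed
      with lift-env-step e ok ag (λ i fr → free⇒typed ok d fr) (λ er → changed (er , ≈-refl T))
    ... | L̂₂ , st , ok₂ , ag₂ with lift-to-closed rc (step-env st)
    ... | C' , r' , rc' = sn-subclosure (h r') (<-wellFounded _) ok₂ d ag₂ rc'
    sn-qrst-step sn-C {T = T} s ok d ag rc L₂ T₂ (st-eq er) changed = ⊥-elim (changed (≡⇒≈ er , ≈-refl T))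
    sn-qrst-step sn-C (acc smaller) ok d ag rc L₂ T₂ (st-sub s) changed with subclosure-step s ok d ag
    ... | lt , _ , _ , _ , ok₂ , d₂ , ag₂ , s' = sn-subclosure sn-C (smaller lt) ok₂ d₂ ag₂ (rc ◅◅ (s' ◅ ε))

  valid⇒sn : S → ∀ {A L T} → Valid A L T → SN L T
  valid⇒sn s₀ {T = T} valid with valid⇒typable valid
  ... | Γ , σ , L∶Γ , T∶σ with mask s₀ L∶Γ
  ... | L̂ , Γ̂ , L̂∶Γ̂ , allTyped , Γ≤Γ̂ , agree with close-typed L̂∶Γ̂ allTyped (Skel-mono T∶σ Γ≤Γ̂)
  ... | _ , C∶τ = sn-subclosure (closed-sn C∶τ) (<-wellFounded _) L∶Γ T∶σ agree (reach-close L̂ T)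

-- Theorem 4.4.
theorem4p4 : (Srt : Set) → DecidableEquality Srt → Srt → (next : Srt → Srt) →
    (A : ℕ → Set) (L : System.Env Srt next) (T : System.Term Srt next) →
    System.Valid Srt next A L T → System.SN Srt next L T
theorem4p4 Srt _ s₀ next A L T = Source.valid⇒sn Srt next s₀
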